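{- Let $\mathcal C\subseteq 2^{[n]}$ be a degree two code. Then a neuron $i\in[n]$ is a $k$-piercing of $\mathcal C$ if and only if $i$ is an elimination neuron of $\mathcal C$ having exactly $k$ neighbors in $G(\mathcal C)$.
   Context: $[n]=\{1,\dots,n\}$. A code is a set $\mathcal C\subseteq 2^{[n]}$ satisfying the standing conventions: $\emptyset\in\mathcal C$; every neuron lies in some codeword; no two distinct neurons lie in exactly the same codewords. $[\sigma,\tau]=\{\gamma:\sigma\subseteq\gamma\subseteq\tau\}$ has rank $|\tau\setminus\sigma|$; $\mathcal C\setminus i$ removes $i$ from every codeword. A neuron $i$ is a $k$-piercing of $\mathcal C$ if there are $\sigma\subseteq\tau\subseteq[n]\setminus\{i\}$ with $[\sigma,\tau]$ of rank $k$, $[\sigma,\tau]\subseteq\mathcal C\setminus i$, and $\mathcal C=(\mathcal C\setminus i)\cup[\sigma\cup\{i\},\tau\cup\{i\}]$. Pseudo-monomials are $\prod_{i\in\sigma}x_i\prod_{j\in\tau}(1-x_j)\in\mathbb F_2[x_1,\dots,x_n]$ with $\sigma\cap\tau=\emptyset$, ordered by divisibility; $J_{\mathcal C}=\langle\prod_{i\in\sigma}x_i\prod_{j\notin\sigma}(1-x_j):\sigma\notin\mathcal C\rangle$ and $\mathrm{CF}(J_{\mathcal C})$ is its set of minimal pseudo-monomials. $\mathcal C$ is degree two if every element of $\mathrm{CF}(J_{\mathcal C})$ has degree two. For degree two $\mathcal C$: $G(\mathcal C)$ is the graph on $[n]$ with edge $ij$ iff no element of $\mathrm{CF}(J_{\mathcal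 C})$ has variables $x_i$ and $x_j$; $P(\mathcal C)$ is the partial order on $[n]$ with $i<j$ iff $x_i(1-x_j)\in\mathrm{CF}(J_{\mathcal C})$. A vertex is simplicial if its neighborhood is a clique. A neuron $i$ is an elimination neuron if it is a simplicial vertex of $G(\mathcal C)$ and a minimal element of $P(\mathcal C)$. -}

module Defs where

open import Data.Nat as ℕ using (ℕ; zero; suc; _%_)
import Data.Nat.Properties as ℕP
open import Data.Bool using (Bool; true; false; if_then_else_)
open import Data.Fin using (Fin; _≟_)
open import Data.Fin.Subset public
  using (Subset; _∈_; _∉_; _⊆_; _∪_; _∩_; _─_; _-_; ⁅_⁆; ∁; ∣_∣; Empty)
open import Data.Vec using (Vec; zipWith; replicate; tabulate; lookup)
import Data.Vec.Properties as VecP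
open import Data.List using (List; []; _∷_; _++_; map; concatMap; filter; length; foldr; allFin)
open import Data.List.Relation.Unary.All using (All)
open import Data.Product using (Σ; _×_; _,_; ∃; ∃-syntax)
open import Data.Sum using (_⊎_)
open import Relation.Binary.PropositionalEquality using (_≡_; _≢_)
open import Relation.Nullary using (¬_)
open import Relation.Nullary.Decidable using (isYes)
import Data.Product
open import Function.Bundles using (_⇔_)

Code : ℕ → Set
Code n = Subset n → Bool

_∈C_ : ∀ {n} → Subset n → Code n → Set
γ ∈C C = C γ ≡ true

record IsCode {n : ℕ} (C : Code n) : Set where
  field
    empty∈     : ∀ γ → Empty γ → γ ∈C C
    covered    : ∀ (i : Fin n) → ∃[ c ] (c ∈C C × i ∈ c)
    separated  : ∀ (i j : Fin n) → i ≢ j →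
                 ¬ (∀ c → c ∈C C → (i ∈ c ⇔ j ∈ c))

_∈C∖_,_ : ∀ {n} → Subset n → Code n → Fin n → Set
γ ∈C∖ C , i = ∃[ c ] (c ∈C C × γ ≡ c - i)

InInterval : ∀ {n} → Subset n → Subset n → Subset n → Set
InInterval σ τ γ = σ ⊆ γ × γ ⊆ τ

rank : ∀ {n} → Subset n → Subset n → ℕ
rank σ τ = ∣ τ ─ σ ∣

IsPiercing : ∀ {n} → Code n → Fin n → ℕ → Set
IsPiercing {n} C i k =
  ∃[ σ ] ∃[ τ ] (σ ⊆ τ × i ∉ τ × rank σ τ ≡ k
    × (∀ γ → InInterval σ τ γ → γ ∈C∖ C , i)
    × (∀ γ → (γ ∈C C) ⇔ ((γ ∈C∖ C , i)
                         ⊎ InInterval (σ ∪ ⁅ i ⁆) (τ ∪ ⁅ i ⁆) γ)))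

-- The polynomial ring F₂[x₁,…,xₙ].
-- A monomial is an exponent vector; a polynomial is a finite list of
-- monomials, the coefficient of a monomial being the parity of its number
-- of occurrences.

Mono : ℕ → Set
Mono n = Vec ℕ n

Poly : ℕ → Set
Poly n = List (Mono n)

coeff : ∀ {n} → Poly n → Mono n → ℕ
coeff p m = length (filter (VecP.≡-dec ℕP._≟_ m) p) % 2

_≈_ : ∀ {n} → Poly n → Poly n → Set
p ≈ q = ∀ m → coeff p m ≡ coeff q m

0P : ∀ {n} → Poly n
0P = []

1P : ∀ {n} → Poly n
1P = replicate _ 0 ∷ []

x : ∀ {n} → Fin n → Poly n
x i = tabulate (λ j → if isYes (i ≟ j) then 1 else 0) ∷ []

_+P_ : ∀ {n} → Poly n → Poly n → Poly n
p +P q = p ++ q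

_*P_ : ∀ {n} → Poly n → Poly n → Poly n
p *P q = concatMap (λ a → map (zipWith ℕ._+_ a) q) p

sumP : ∀ {n} → List (Poly n) → Poly n
sumP = foldr _+P_ 0P

prodP : ∀ {n} → List (Poly n) → Poly n
prodP = foldr _*P_ 1P

_∣P_ : ∀ {n} → Poly n → Poly n → Set
p ∣P q = ∃[ h ] (q ≈ (p *P h))

-- Pseudo-monomials  ∏_{i∈σ} x_i ∏_{j∈τ} (1 - x_j)   (σ ∩ τ = ∅).
-- In characteristic 2, 1 - x_j = 1 + x_j.

Disjoint : ∀ {n} → Subset n → Subset n → Set
Disjoint σ τ = Empty (σ ∩ τ)

pm : ∀ {n} → Subset n → Subset n → Poly n
pm {n} σ τ = prodP (map factor (allFin n))
  where
  factor : Fin n → Poly n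
  factor i = if lookup σ i then x i
             else (if lookup τ i then (1P +P x i) else 1P)

ρ : ∀ {n} → Subset n → Poly n
ρ σ = pm σ (∁ σ)

InJ : ∀ {n} → Code n → Poly n → Set
InJ {n} C f =
  ∃[ gs ] (All (λ (g,σ : Poly n × Subset n) → C (Data.Product.proj₂ g,σ) ≡ false) gs
           × f ≈ sumP (map (λ (g,σ : Poly n × Subset n) →
                               Data.Product.proj₁ g,σ *P ρ (Data.Product.proj₂ g,σ)) gs))

InCF : ∀ {n} → Code n → Subset n → Subset n → Set
InCF C σ τ =
  Disjoint σ τ × InJ C (pm σ τ)
  × (∀ σ' τ' → Disjoint σ' τ' → InJ C (pm σ' τ') →
       pm σ' τ' ∣P pm σ τ → pm σ' τ' ≈ pm σ τ)

DegreeTwo : ∀ {n} → Code n → Set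
DegreeTwo C = ∀ σ τ → InCF C σ τ → ∣ σ ∣ ℕ.+ ∣ τ ∣ ≡ 2

Edge : ∀ {n} → Code n → Fin n → Fin n → Set
Edge C i j = i ≢ j ×
  ¬ (∃[ σ ] ∃[ τ ] (InCF C σ τ × i ∈ (σ ∪ τ) × j ∈ (σ ∪ τ)))

_<P[_]_ : ∀ {n} → Fin n → Code n → Fin n → Set
i <P[ C ] j = InCF C ⁅ i ⁆ ⁅ j ⁆

Simplicial : ∀ {n} → Code n → Fin n → Set
Simplicial C i = ∀ j l → Edge C i j → Edge C i l → j ≢ l → Edge C j l

MinimalP : ∀ {n} → Code n → Fin n → Set
MinimalP C i = ∀ j → ¬ (j <P[ C ] i)

ElimNeuron : ∀ {n} → Code n → Fin n → Set
ElimNeuron C i = Simplicial C i × MinimalP C i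

NeighbourCount : ∀ {n} → Code n → Fin n → ℕ → Set
NeighbourCount C i k = ∃[ N ] ((∀ j → (j ∈ N) ⇔ Edge C i j) × ∣ N ∣ ≡ k)

-- A pseudo-monomial x^σ (1 - x)^τ lies in J_C exactly when no codeword c satisfies
-- σ ⊆ c ⊆ ∁ τ: evaluating at codewords gives one direction, and splitting
-- x^σ (1 - x)^τ = x^(σ ∪ k) (1 - x)^τ + x^σ (1 - x)^(τ ∪ k) down to the generators
-- ρ_c, c ∉ C, gives the other.  As divisibility of pseudo-monomials is inclusion of
-- index pairs, CF(J_C) consists of the minimal forbidden pairs (σ , τ).  When C has
-- degree two these involve only two neurons, so G(C) and P(C) record which of the
-- four on/off patterns of two neurons occur in C, and a set all of whose pair
-- patterns occur is a codeword.
--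
-- If i pierces [σ , τ], the codewords σ ∪ {j} and σ ∪ {j , i} show that the
-- neighbours of i are exactly τ ∖ σ, and that i is simplicial and minimal.
-- Conversely, for an elimination neuron i with neighbourhood N, let σ be the
-- neurons that fire whenever i does and τ = σ ∪ N; simpliciality and minimality of
-- i supply every pair pattern needed to show C = (C ∖ i) ∪ [σ ∪ i , τ ∪ i].

module Submission where

open import Defs

open import Algebra.Bundles using (CommutativeRing)
open import Data.Bool as Bool using (Bool; true; false; not; _∧_; _∨_; _xor_; if_then_else_)
import Data.Bool.Properties as BoolP
open import Data.Empty using (⊥-elim)
open import Data.Fin as Fin using (Fin; zero; suc)
import Data.Fin.Properties as FinP
open import Data.Fin.Subset using (Nonempty; ⊥)
open import Data.Fin.Subset.Properties
  using ( _∈?_; _⊆?_; nonempty?; anySubset?; ⊆-antisym; ∉⊥; x∈⁅x⁆; x∈⁅y⁆⇒x≡y; x≢y⇒x∉⁅y⁆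
        ; p⊆p∪q; q⊆p∪q; x∈p∪q⁻; x∈p∩q⁺; x∈p∩q⁻; x∉p⇒x∈∁p; x∈p⇒x∉∁p; x∉∁p⇒x∈p; x∈∁p⇒x∉p
        ; p─q⊆p; x∈p∧x∉q⇒x∈p─q; x∈p∧x≢y⇒x∈p-y; p⊆q⇒∁p⊇∁q
        ; ∣p∣≤∣x∷p∣; x∈p⇒∣p-x∣<∣p∣; p⊂q⇒∣p∣<∣q∣ )
open import Data.List as List using (List; []; _∷_; _++_; [_]; map; filter; length; allFin)
import Data.List.Properties as ListP
open import Data.List.Membership.Propositional using () renaming (_∈_ to _∈ₗ_)
open import Data.List.Membership.Propositional.Properties using (∈-∃++; ∈-allFin)
open import Data.List.Relation.Unary.All as All using (All; []; _∷_)
import Data.List.Relation.Unary.All.Properties as AllP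
open import Data.List.Relation.Unary.AllPairs using (_∷_)
open import Data.List.Relation.Unary.Any using (here; there)
open import Data.List.Relation.Unary.Unique.Propositional using (Unique)
open import Data.List.Relation.Unary.Unique.Propositional.Properties using (allFin⁺)
open import Data.Nat as ℕ using (ℕ; zero; suc; _+_; _%_; _≤_; _<_; z≤n; s≤s)
import Data.Nat.Properties as ℕP
open import Data.Product using (_×_; _,_; proj₁; proj₂; ∃-syntax; ∃₂; uncurry)
open import Data.Sum as Sum using (_⊎_; inj₁; inj₂; [_,_]′)
import Data.Vec as Vec
open import Data.Vec using ([]; _∷_; zipWith; replicate; tabulate; lookup)
import Data.Vec.Properties as VecP
open import Function using (case_of_; _∘_; _∘′_; id; flip)
open import Function.Bundles using (_⇔_; mk⇔; Equivalence)
open import Level using (0ℓ)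
open import Relation.Binary.Bundles using (Setoid)
open import Relation.Binary.PropositionalEquality hiding ([_])
import Relation.Binary.Reasoning.Setoid as SetoidReasoning
open import Relation.Nullary using (¬_; Dec; yes; no)
open import Relation.Nullary.Decidable using (isYes; toWitness; fromWitness; _×-dec_; ¬?)
open import Relation.Unary using (Pred; Decidable)

open CommutativeRing BoolP.xor-∧-commutativeRing using (+-commutativeSemigroup)
open import Algebra.Properties.CommutativeSemigroup +-commutativeSemigroup using (interchange; x∙yz≈y∙xz)

-- Equality in F₂[x] as equality of coefficient parities

xor-xor : ∀ a b → a xor (a xor b) ≡ b
xor-xor false b = refl
xor-xor true b = BoolP.not-involutive b

isOdd : ℕ → Bool
isOdd zero = false
isOdd (suc a) = not (isOdd a)

isOdd-+ : ∀ a b → isOdd (a + b) ≡ isOdd a xor isOdd b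
isOdd-+ zero b = refl
isOdd-+ (suc a) b = trans (cong not (isOdd-+ a b)) (BoolP.not-distribˡ-xor (isOdd a) (isOdd b))

bit : Bool → ℕ
bit b = if b then 1 else 0

bit-injective : ∀ {a b} → bit a ≡ bit b → a ≡ b
bit-injective {false} {false} _ = refl
bit-injective {true} {true} _ = refl

%2≡bit∘isOdd : ∀ a → a % 2 ≡ bit (isOdd a)
%2≡bit∘isOdd zero = refl
%2≡bit∘isOdd (suc zero) = refl
%2≡bit∘isOdd (suc (suc a)) =
  trans (%2≡bit∘isOdd a) (cong bit (sym (BoolP.not-involutive (isOdd a))))

module _ {n : ℕ} where

  count : Mono n → Poly n → ℕ
  count m p = length (filter (VecP.≡-dec ℕP._≟_ m) p)

  oddCount : Mono n → Poly n → Bool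
  oddCount m p = isOdd (count m p)

  Additive : (Poly n → Bool) → Set
  Additive h = ∀ p q → h (p ++ q) ≡ h p xor h q

  oddCount-additive : ∀ m → Additive (oddCount m)
  oddCount-additive m p q = begin
    isOdd (length (filter _ (p ++ q)))           ≡⟨ cong (isOdd ∘′ length) (ListP.filter-++ _ p q) ⟩
    isOdd (length (filter _ p ++ filter _ q))    ≡⟨ cong isOdd (ListP.length-++ (filter _ p)) ⟩
    isOdd (count m p + count m q)                ≡⟨ isOdd-+ (count m p) (count m q) ⟩
    oddCount m p xor oddCount m q                ∎
    where open ≡-Reasoning

  oddCount-[m] : ∀ m → oddCount m [ m ] ≡ true
  oddCount-[m] m with VecP.≡-dec ℕP._≟_ m m
  ... | yes _ = refl
  ... | no m≢m = ⊥-elim (m≢m refl)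

  oddCount⇒∈ : ∀ m p → oddCount m p ≡ true → m ∈ₗ p
  oddCount⇒∈ m [] ()
  oddCount⇒∈ m (a ∷ p) odd with VecP.≡-dec ℕP._≟_ m a
  ... | yes refl = here refl
  ... | no _ = there (oddCount⇒∈ m p odd)

  -- A record rather than a function type (as _≈_ is), so that p and q can be inferred.
  infix 4 _≋_
  record _≋_ (p q : Poly n) : Set where
    constructor mk≋
    field oddCount-≡ : ∀ m → oddCount m p ≡ oddCount m q
  open _≋_

  ≈⇒≋ : ∀ {p q} → p ≈ q → p ≋ q
  ≈⇒≋ {p} {q} p≈q = mk≋ λ m → bit-injective
    (trans (sym (%2≡bit∘isOdd (count m p))) (trans (p≈q m) (%2≡bit∘isOdd (count m q))))

  ≋⇒≈ : ∀ {p q} → p ≋ q → p ≈ q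
  ≋⇒≈ {p} {q} p≋q m =
    trans (%2≡bit∘isOdd (count m p)) (trans (cong bit (oddCount-≡ p≋q m)) (sym (%2≡bit∘isOdd (count m q))))

  ≋-reflexive : ∀ {p q} → p ≡ q → p ≋ q
  ≋-reflexive refl = mk≋ λ _ → refl

  ≋-sym : ∀ {p q} → p ≋ q → q ≋ p
  ≋-sym e = mk≋ λ m → sym (oddCount-≡ e m)

  ≋-trans : ∀ {p q r} → p ≋ q → q ≋ r → p ≋ r
  ≋-trans e f = mk≋ λ m → trans (oddCount-≡ e m) (oddCount-≡ f m)

  ≋-setoid : Setoid 0ℓ 0ℓ
  ≋-setoid = record
    { Carrier = Poly n ; _≈_ = _≋_
    ; isEquivalence = record { refl = ≋-reflexive refl ; sym = ≋-sym ; trans = ≋-trans } }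

  module ≋-Reasoning = SetoidReasoning ≋-setoid

  ++-cong-≋ : ∀ {p p′ q q′} → p ≋ p′ → q ≋ q′ → p ++ q ≋ p′ ++ q′
  ++-cong-≋ {p} {p′} {q} {q′} e f = mk≋ λ m → begin
    oddCount m (p ++ q)                 ≡⟨ oddCount-additive m p q ⟩
    oddCount m p xor oddCount m q       ≡⟨ cong₂ _xor_ (oddCount-≡ e m) (oddCount-≡ f m) ⟩
    oddCount m p′ xor oddCount m q′     ≡⟨ oddCount-additive m p′ q′ ⟨
    oddCount m (p′ ++ q′)               ∎
    where open ≡-Reasoning

  module AdditiveProperties (h : Poly n → Bool) (additive : Additive h) where

    additive-[] : h [] ≡ false
    additive-[] = begin
      h []                              ≡⟨ xor-xor (h []) (h []) ⟨
      h [] xor (h [] xor h [])          ≡⟨ cong (h [] xor_) (additive [] []) ⟨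
      h [] xor h []                     ≡⟨ BoolP.xor-same (h []) ⟩
      false                             ∎
      where open ≡-Reasoning

    additive-∷ : ∀ m p → h (m ∷ p) ≡ h [ m ] xor h p
    additive-∷ m = additive [ m ]

    additive-cancel-pair : ∀ m p₁ p₂ → h (m ∷ p₁ ++ m ∷ p₂) ≡ h (p₁ ++ p₂)
    additive-cancel-pair m p₁ p₂ = begin
      h (m ∷ p₁ ++ m ∷ p₂)                       ≡⟨ additive-∷ m (p₁ ++ m ∷ p₂) ⟩
      h [ m ] xor h (p₁ ++ [ m ] ++ p₂)          ≡⟨ cong (h [ m ] xor_) (additive p₁ _) ⟩
      h [ m ] xor (h p₁ xor h (m ∷ p₂))          ≡⟨ cong (λ b → h [ m ] xor (h p₁ xor b)) (additive-∷ m p₂) ⟩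
      h [ m ] xor (h p₁ xor (h [ m ] xor h p₂))  ≡⟨ cong (h [ m ] xor_) (x∙yz≈y∙xz (h p₁) (h [ m ]) (h p₂)) ⟩
      h [ m ] xor (h [ m ] xor (h p₁ xor h p₂))  ≡⟨ xor-xor (h [ m ]) _ ⟩
      h p₁ xor h p₂                              ≡⟨ additive p₁ p₂ ⟨
      h (p₁ ++ p₂)                               ∎
      where open ≡-Reasoning

  private
    length-∷-middle : ∀ (p₁ : Poly n) m p₂ → length (p₁ ++ m ∷ p₂) ≡ suc (length (p₁ ++ p₂))
    length-∷-middle [] m p₂ = refl
    length-∷-middle (a ∷ p₁) m p₂ = cong suc (length-∷-middle p₁ m p₂)

  module _ (h : Poly n → Bool) (additive : Additive h) where
    open AdditiveProperties h additive

    -- A monomial of a polynomial equal to 0 occurs a second time, and the pair cancels.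
    additive-≋[] : ∀ {N} q → length q ≤ N → q ≋ [] → h q ≡ false
    additive-≋[] [] _ _ = additive-[]
    additive-≋[] {suc N} (m ∷ q) (s≤s |q|≤N) q≋[] with ∈-∃++ (oddCount⇒∈ m q odd)
      where
      not-odd : not (oddCount m q) ≡ false
      not-odd = begin
        true xor oddCount m q              ≡⟨ cong (_xor oddCount m q) (oddCount-[m] m) ⟨
        oddCount m [ m ] xor oddCount m q  ≡⟨ oddCount-additive m [ m ] q ⟨
        oddCount m (m ∷ q)                 ≡⟨ oddCount-≡ q≋[] m ⟩
        false                              ∎
        where open ≡-Reasoning
      odd : oddCount m q ≡ true
      odd = trans (sym (BoolP.not-involutive _)) (cong not not-odd)
    ... | q₁ , q₂ , refl = trans (additive-cancel-pair m q₁ q₂) (additive-≋[] (q₁ ++ q₂) shorter q₁++q₂≋[])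
      where
      shorter : length (q₁ ++ q₂) ≤ N
      shorter = ℕP.<⇒≤ (ℕP.≤-trans (ℕP.≤-reflexive (sym (length-∷-middle q₁ m q₂))) |q|≤N)
      q₁++q₂≋[] : q₁ ++ q₂ ≋ []
      q₁++q₂≋[] = ≋-trans (mk≋ λ m′ → sym (AdditiveProperties.additive-cancel-pair
                                                (oddCount m′) (oddCount-additive m′) m q₁ q₂)) q≋[]

    additive-resp-≋ : ∀ {p q} → p ≋ q → h p ≡ h q
    additive-resp-≋ {[]} {q} []≋q = trans additive-[] (sym (additive-≋[] q ℕP.≤-refl (≋-sym []≋q)))
    additive-resp-≋ {m ∷ p} {q} m∷p≋q = begin
      h (m ∷ p)                    ≡⟨ additive-∷ m p ⟩
      h [ m ] xor h p              ≡⟨ cong (h [ m ] xor_) (additive-resp-≋ p≋m∷q) ⟩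
      h [ m ] xor h (m ∷ q)        ≡⟨ cong (h [ m ] xor_) (additive-∷ m q) ⟩
      h [ m ] xor (h [ m ] xor h q) ≡⟨ xor-xor (h [ m ]) (h q) ⟩
      h q                          ∎
      where
      open ≡-Reasoning
      p≋m∷q : p ≋ m ∷ q
      p≋m∷q = mk≋ λ m′ → begin
        oddCount m′ p                                        ≡⟨ xor-xor (oddCount m′ [ m ]) (oddCount m′ p) ⟨
        oddCount m′ [ m ] xor (oddCount m′ [ m ] xor oddCount m′ p) ≡⟨ cong (oddCount m′ [ m ] xor_) (oddCount-additive m′ [ m ] p) ⟨
        oddCount m′ [ m ] xor oddCount m′ (m ∷ p)            ≡⟨ cong (oddCount m′ [ m ] xor_) (oddCount-≡ m∷p≋q m′) ⟩
        oddCount m′ [ m ] xor oddCount m′ q                  ≡⟨ oddCount-additive m′ [ m ] q ⟨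
        oddCount m′ (m ∷ q)                                  ∎

  *P-distribʳ-++ : ∀ (p₁ p₂ q : Poly n) → (p₁ ++ p₂) *P q ≡ p₁ *P q ++ p₂ *P q
  *P-distribʳ-++ p₁ p₂ q = ListP.concatMap-++ (λ a → map (zipWith _+_ a) q) p₁ p₂

  oddCount-*P-additiveˡ : ∀ m (p : Poly n) → Additive (λ q → oddCount m (p *P q))
  oddCount-*P-additiveˡ m [] q₁ q₂ = refl
  oddCount-*P-additiveˡ m (a ∷ p) q₁ q₂ = begin
    oddCount m (shift (q₁ ++ q₂) ++ p *P (q₁ ++ q₂))
      ≡⟨ oddCount-additive m (shift (q₁ ++ q₂)) _ ⟩
    oddCount m (shift (q₁ ++ q₂)) xor oddCount m (p *P (q₁ ++ q₂))
      ≡⟨ cong₂ _xor_ (trans (cong (oddCount m) (ListP.map-++ _ q₁ q₂)) (oddCount-additive m (shift q₁) _))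
                     (oddCount-*P-additiveˡ m p q₁ q₂) ⟩
    (oddCount m (shift q₁) xor oddCount m (shift q₂)) xor (oddCount m (p *P q₁) xor oddCount m (p *P q₂))
      ≡⟨ interchange (oddCount m (shift q₁)) _ _ _ ⟩
    (oddCount m (shift q₁) xor oddCount m (p *P q₁)) xor (oddCount m (shift q₂) xor oddCount m (p *P q₂))
      ≡⟨ cong₂ _xor_ (oddCount-additive m (shift q₁) _) (oddCount-additive m (shift q₂) _) ⟨
    oddCount m ((a ∷ p) *P q₁) xor oddCount m ((a ∷ p) *P q₂)
      ∎
    where
    open ≡-Reasoning
    shift : Poly n → Poly n
    shift = map (zipWith _+_ a)

  *P-congʳ : ∀ {p p′ : Poly n} q → p ≋ p′ → p *P q ≋ p′ *P q
  *P-congʳ q p≋p′ = mk≋ λ m → additive-resp-≋ (λ p → oddCount m (p *P q))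
    (λ p₁ p₂ → trans (cong (oddCount m) (*P-distribʳ-++ p₁ p₂ q)) (oddCount-additive m (p₁ *P q) (p₂ *P q))) p≋p′

  *P-congˡ : ∀ (p : Poly n) {q q′} → q ≋ q′ → p *P q ≋ p *P q′
  *P-congˡ p q≋q′ = mk≋ λ m → additive-resp-≋ (λ q → oddCount m (p *P q)) (oddCount-*P-additiveˡ m p) q≋q′

  *P-distribˡ-++ : ∀ (p q₁ q₂ : Poly n) → p *P (q₁ ++ q₂) ≋ p *P q₁ ++ p *P q₂
  *P-distribˡ-++ p q₁ q₂ = mk≋ λ m →
    trans (oddCount-*P-additiveˡ m p q₁ q₂) (sym (oddCount-additive m (p *P q₁) (p *P q₂)))

  *P-identityˡ : ∀ (p : Poly n) → 1P *P p ≡ p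
  *P-identityˡ p = begin
    map (zipWith _+_ (replicate n 0)) p ++ [] ≡⟨ ListP.++-identityʳ _ ⟩
    map (zipWith _+_ (replicate n 0)) p       ≡⟨ ListP.map-cong (VecP.zipWith-identityˡ ℕP.+-identityˡ) p ⟩
    map id p                                  ≡⟨ ListP.map-id p ⟩
    p                                         ∎
    where open ≡-Reasoning

-- Evaluation at points of {0,1}ⁿ

evalMono : ∀ {n} → Mono n → Subset n → Bool
evalMono [] [] = true
evalMono (zero ∷ m) (_ ∷ v) = evalMono m v
evalMono (suc _ ∷ m) (b ∷ v) = b ∧ evalMono m v

eval : ∀ {n} → Poly n → Subset n → Bool
eval [] v = false
eval (m ∷ p) v = evalMono m v xor eval p v

module _ {n : ℕ} where

  eval-additive : (v : Subset n) → Additive (λ p → eval p v)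
  eval-additive v [] q = refl
  eval-additive v (m ∷ p) q =
    trans (cong (evalMono m v xor_) (eval-additive v p q)) (sym (BoolP.xor-assoc (evalMono m v) _ _))

  evalMono-zipWith-+ : ∀ {k} (a b : Mono k) v → evalMono (zipWith _+_ a b) v ≡ evalMono a v ∧ evalMono b v
  evalMono-zipWith-+ [] [] [] = refl
  evalMono-zipWith-+ (zero ∷ a) (zero ∷ b) (_ ∷ v) = evalMono-zipWith-+ a b v
  evalMono-zipWith-+ (zero ∷ a) (suc _ ∷ b) (false ∷ v) = sym (BoolP.∧-zeroʳ (evalMono a v))
  evalMono-zipWith-+ (zero ∷ a) (suc _ ∷ b) (true ∷ v) = evalMono-zipWith-+ a b v
  evalMono-zipWith-+ (suc _ ∷ a) (zero ∷ b) (false ∷ v) = refl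
  evalMono-zipWith-+ (suc _ ∷ a) (zero ∷ b) (true ∷ v) = evalMono-zipWith-+ a b v
  evalMono-zipWith-+ (suc _ ∷ a) (suc _ ∷ b) (false ∷ v) = refl
  evalMono-zipWith-+ (suc _ ∷ a) (suc _ ∷ b) (true ∷ v) = evalMono-zipWith-+ a b v

  eval-*P : ∀ (p q : Poly n) v → eval (p *P q) v ≡ eval p v ∧ eval q v
  eval-*P [] q v = refl
  eval-*P (a ∷ p) q v = begin
    eval (map (zipWith _+_ a) q ++ p *P q) v            ≡⟨ eval-additive v (map (zipWith _+_ a) q) (p *P q) ⟩
    eval (map (zipWith _+_ a) q) v xor eval (p *P q) v  ≡⟨ cong₂ _xor_ (eval-shift q) (eval-*P p q v) ⟩
    evalMono a v ∧ eval q v xor eval p v ∧ eval q v     ≡⟨ BoolP.∧-distribʳ-xor (eval q v) (evalMono a v) (eval p v) ⟨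
    eval (a ∷ p) v ∧ eval q v                           ∎
    where
    open ≡-Reasoning
    eval-shift : ∀ q → eval (map (zipWith _+_ a) q) v ≡ evalMono a v ∧ eval q v
    eval-shift [] = sym (BoolP.∧-zeroʳ (evalMono a v))
    eval-shift (m ∷ q) = trans (cong₂ _xor_ (evalMono-zipWith-+ a m v) (eval-shift q))
      (sym (BoolP.∧-distribˡ-xor (evalMono a v) (evalMono m v) (eval q v)))

  eval-1P : ∀ (v : Subset n) → eval 1P v ≡ true
  eval-1P v = cong (_xor false) (evalMono-replicate-0 v)
    where
    evalMono-replicate-0 : ∀ {k} (v : Subset k) → evalMono (replicate k 0) v ≡ true
    evalMono-replicate-0 [] = refl
    evalMono-replicate-0 (_ ∷ v) = evalMono-replicate-0 v

  eval-x : ∀ (i : Fin n) v → eval (x i) v ≡ lookup v i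
  eval-x i v = trans (BoolP.xor-identityʳ _) (evalMono-indicator i v)
    where
    evalMono-tabulate-0 : ∀ {k} (v : Subset k) → evalMono (tabulate {n = k} (λ _ → 0)) v ≡ true
    evalMono-tabulate-0 [] = refl
    evalMono-tabulate-0 (_ ∷ v) = evalMono-tabulate-0 v
    isYes-suc≟suc : ∀ {k} (i j : Fin k) → isYes (suc i Fin.≟ suc j) ≡ isYes (i Fin.≟ j)
    isYes-suc≟suc i j with i Fin.≟ j
    ... | yes _ = refl
    ... | no _ = refl
    evalMono-indicator : ∀ {k} (i : Fin k) v →
      evalMono (tabulate (λ j → if isYes (i Fin.≟ j) then 1 else 0)) v ≡ lookup v i
    evalMono-indicator zero (b ∷ v) = trans (cong (b ∧_) (evalMono-tabulate-0 v)) (BoolP.∧-identityʳ b)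
    evalMono-indicator (suc i) (b ∷ v) = trans
      (cong (λ m → evalMono (0 ∷ m) (b ∷ v))
            (VecP.tabulate-cong λ j → cong (λ d → if d then 1 else 0) (isYes-suc≟suc i j)))
      (evalMono-indicator i v)

  eval-resp-≈ : ∀ (p q : Poly n) v → p ≈ q → eval p v ≡ eval q v
  eval-resp-≈ p q v p≈q = additive-resp-≋ (λ p → eval p v) (eval-additive v) (≈⇒≋ {p = p} {q = q} p≈q)

x∈p─q⇒x∉q : ∀ {n} {p q : Subset n} {i} → i ∈ p ─ q → i ∉ q
x∈p─q⇒x∉q {p = true ∷ p} {false ∷ q} {zero} _ ()
x∈p─q⇒x∉q {p = _ ∷ p} {_ ∷ q} {suc i} (Vec.there i∈p─q) (Vec.there i∈q) = x∈p─q⇒x∉q {p = p} {q} i∈p─q i∈q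

x∉p-x : ∀ {n} {p : Subset n} {i} → i ∉ p - i
x∉p-x {p = p} {i} i∈p-i = x∈p─q⇒x∉q {p = p} i∈p-i (x∈⁅x⁆ i)

∣p∪q∣≤∣p∣+∣q∣ : ∀ {n} (p q : Subset n) → ∣ p ∪ q ∣ ≤ ∣ p ∣ + ∣ q ∣
∣p∪q∣≤∣p∣+∣q∣ [] [] = z≤n
∣p∪q∣≤∣p∣+∣q∣ (true ∷ p) (b ∷ q) = s≤s (ℕP.≤-trans (∣p∪q∣≤∣p∣+∣q∣ p q) (ℕP.+-monoʳ-≤ ∣ p ∣ (∣p∣≤∣x∷p∣ b q)))
∣p∪q∣≤∣p∣+∣q∣ (false ∷ p) (true ∷ q) = ℕP.≤-trans (s≤s (∣p∪q∣≤∣p∣+∣q∣ p q)) (ℕP.≤-reflexive (sym (ℕP.+-suc ∣ p ∣ ∣ q ∣)))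
∣p∪q∣≤∣p∣+∣q∣ (false ∷ p) (false ∷ q) = ∣p∪q∣≤∣p∣+∣q∣ p q

three-elements⇒3≤∣p∣ : ∀ {n} {p : Subset n} {a b c} → a ∈ p → b ∈ p → c ∈ p → b ≢ a → c ≢ a → c ≢ b → 3 ≤ ∣ p ∣
three-elements⇒3≤∣p∣ {p = p} {a} {b} {c} a∈p b∈p c∈p b≢a c≢a c≢b = begin
  3                       ≤⟨ s≤s (s≤s (s≤s z≤n)) ⟩
  suc (suc (suc ∣ p - a - b - c ∣)) ≤⟨ s≤s (s≤s (x∈p⇒∣p-x∣<∣p∣ c∈p-a-b)) ⟩
  suc (suc ∣ p - a - b ∣)  ≤⟨ s≤s (x∈p⇒∣p-x∣<∣p∣ b∈p-a) ⟩
  suc ∣ p - a ∣            ≤⟨ x∈p⇒∣p-x∣<∣p∣ a∈p ⟩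
  ∣ p ∣                    ∎
  where
  open ℕP.≤-Reasoning
  b∈p-a = x∈p∧x≢y⇒x∈p-y b∈p b≢a
  c∈p-a-b = x∈p∧x≢y⇒x∈p-y (x∈p∧x≢y⇒x∈p-y c∈p c≢a) c≢b

module _ {n : ℕ} where

  ∈⇒lookup : ∀ {i} {p : Subset n} → i ∈ p → lookup p i ≡ true
  ∈⇒lookup = VecP.[]=⇒lookup

  lookup⇒∈ : ∀ {i} {p : Subset n} → lookup p i ≡ true → i ∈ p
  lookup⇒∈ {i} {p} = VecP.lookup⇒[]= i p

  ∉⇒lookup : ∀ {i} {p : Subset n} → i ∉ p → lookup p i ≡ false
  ∉⇒lookup {i} {p} i∉p with lookup p i in eq
  ... | true = ⊥-elim (i∉p (lookup⇒∈ eq))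
  ... | false = refl

  select : ∀ {P : Pred (Fin n) 0ℓ} → Decidable P → Subset n
  select P? = tabulate (isYes ∘ P?)

  ∈-select⁺ : ∀ {P : Pred (Fin n) 0ℓ} (P? : Decidable P) {j} → P j → j ∈ select P?
  ∈-select⁺ P? {j} Pj = lookup⇒∈ (trans (VecP.lookup∘tabulate (isYes ∘ P?) j)
    (Equivalence.to BoolP.T-≡ (fromWitness {a? = P? j} Pj)))

  ∈-select⁻ : ∀ {P : Pred (Fin n) 0ℓ} (P? : Decidable P) {j} → j ∈ select P? → P j
  ∈-select⁻ P? {j} j∈ = toWitness {a? = P? j}
    (Equivalence.from BoolP.T-≡ (trans (sym (VecP.lookup∘tabulate (isYes ∘ P?) j)) (∈⇒lookup j∈)))

  Disjoint-∉ : ∀ {σ τ : Subset n} {i} → Disjoint σ τ → i ∈ σ → i ∉ τ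
  Disjoint-∉ d i∈σ i∈τ = d (_ , x∈p∩q⁺ (i∈σ , i∈τ))

  p-x≡p : ∀ {p : Subset n} {x} → x ∉ p → p - x ≡ p
  p-x≡p {p} {x} x∉p = ⊆-antisym (p─q⊆p p ⁅ x ⁆) λ j∈p → x∈p∧x≢y⇒x∈p-y j∈p λ { refl → x∉p j∈p }

  p∪⁅x⁆-x≡p : ∀ {p : Subset n} {x} → x ∉ p → (p ∪ ⁅ x ⁆) - x ≡ p
  p∪⁅x⁆-x≡p {p} {x} x∉p = ⊆-antisym ⊆p λ j∈p → x∈p∧x≢y⇒x∈p-y (p⊆p∪q ⁅ x ⁆ j∈p) λ { refl → x∉p j∈p }
    where
    ⊆p : (p ∪ ⁅ x ⁆) - x ⊆ p
    ⊆p j∈ = [ id , ⊥-elim ∘ x∈p─q⇒x∉q {p = p ∪ ⁅ x ⁆} j∈ ]′ (x∈p∪q⁻ p ⁅ x ⁆ (p─q⊆p (p ∪ ⁅ x ⁆) ⁅ x ⁆ j∈))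

  Disjoint⁺ : ∀ {σ τ : Subset n} → (∀ {i} → i ∈ σ → i ∉ τ) → Disjoint σ τ
  Disjoint⁺ {σ} {τ} σ∩τ≡∅ (i , i∈σ∩τ) = let (i∈σ , i∈τ) = x∈p∩q⁻ σ τ i∈σ∩τ in σ∩τ≡∅ i∈σ i∈τ

  Disjoint-∁ : ∀ (σ : Subset n) → Disjoint σ (∁ σ)
  Disjoint-∁ σ (i , i∈σ∩∁σ) = let (i∈σ , i∈∁σ) = x∈p∩q⁻ σ (∁ σ) i∈σ∩∁σ in x∈∁p⇒x∉p i∈∁σ i∈σ

  ∪-least : ∀ {p q r : Subset n} → p ⊆ r → q ⊆ r → p ∪ q ⊆ r
  ∪-least {p} {q} p⊆r q⊆r i∈p∪q = [ p⊆r , q⊆r ]′ (x∈p∪q⁻ p q i∈p∪q)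

  ∪-mono : ∀ {p q r s : Subset n} → p ⊆ r → q ⊆ s → p ∪ q ⊆ r ∪ s
  ∪-mono {r = r} {s} p⊆r q⊆s = ∪-least (p⊆p∪q s ∘ p⊆r) (q⊆p∪q r s ∘ q⊆s)

  ⁅⁆⊆ : ∀ {k} {p : Subset n} → k ∈ p → ⁅ k ⁆ ⊆ p
  ⁅⁆⊆ {k} k∈p i∈⁅k⁆ = subst (_∈ _) (sym (x∈⁅y⁆⇒x≡y k i∈⁅k⁆)) k∈p

  ∉-∪⁅⁆ : ∀ {p : Subset n} {k j} → j ∉ p → j ≢ k → j ∉ p ∪ ⁅ k ⁆
  ∉-∪⁅⁆ {p} {k} j∉p j≢k j∈p∪k = [ j∉p , j≢k ∘ x∈⁅y⁆⇒x≡y k ]′ (x∈p∪q⁻ p ⁅ k ⁆ j∈p∪k)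

  Disjoint-∪⁅⁆ˡ : ∀ {σ τ : Subset n} {k} → Disjoint σ τ → k ∉ τ → Disjoint (σ ∪ ⁅ k ⁆) τ
  Disjoint-∪⁅⁆ˡ {σ} {k = k} d k∉τ = Disjoint⁺ λ i∈σ∪k →
    [ Disjoint-∉ d , (λ i∈⁅k⁆ → subst (_∉ _) (sym (x∈⁅y⁆⇒x≡y k i∈⁅k⁆)) k∉τ) ]′ (x∈p∪q⁻ σ ⁅ k ⁆ i∈σ∪k)

  Disjoint-∪⁅⁆ʳ : ∀ {σ τ : Subset n} {k} → Disjoint σ τ → k ∉ σ → Disjoint σ (τ ∪ ⁅ k ⁆)
  Disjoint-∪⁅⁆ʳ {σ} {τ} {k} d k∉σ = Disjoint⁺ λ i∈σ i∈τ∪k →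
    [ Disjoint-∉ d i∈σ , (λ i∈⁅k⁆ → k∉σ (subst (_∈ σ) (x∈⁅y⁆⇒x≡y k i∈⁅k⁆) i∈σ)) ]′ (x∈p∪q⁻ τ ⁅ k ⁆ i∈τ∪k)

  Disjoint-full⇒≡∁ : ∀ {σ τ : Subset n} → Disjoint σ τ → ¬ Nonempty (∁ (σ ∪ τ)) → τ ≡ ∁ σ
  Disjoint-full⇒≡∁ {σ} {τ} d full = ⊆-antisym (x∉p⇒x∈∁p ∘ flip (Disjoint-∉ d)) ∁σ⊆τ
    where
    ∁σ⊆τ : ∁ σ ⊆ τ
    ∁σ⊆τ {i} i∈∁σ with i ∈? (σ ∪ τ)
    ... | no i∉σ∪τ = ⊥-elim (full (i , x∉p⇒x∈∁p i∉σ∪τ))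
    ... | yes i∈σ∪τ = [ ⊥-elim ∘ x∈∁p⇒x∉p i∈∁σ , id ]′ (x∈p∪q⁻ σ τ i∈σ∪τ)

  ∣∁∣-< : ∀ {A B : Subset n} {k} → A ⊆ B → k ∈ B → k ∉ A → ∣ ∁ B ∣ < ∣ ∁ A ∣
  ∣∁∣-< A⊆B k∈B k∉A = p⊂q⇒∣p∣<∣q∣ (p⊆q⇒∁p⊇∁q A⊆B , _ , x∉p⇒x∈∁p k∉A , x∈p⇒x∉∁p k∈B)

  -- Pseudo-monomials

  Matches : Subset n → Subset n → Subset n → Set
  Matches σ τ v = σ ⊆ v × (∀ {i} → i ∈ τ → i ∉ v)

  factor : Subset n → Subset n → Fin n → Poly n
  factor σ τ i = if lookup σ i then x i else (if lookup τ i then (1P +P x i) else 1P)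

  eval-factor : ∀ σ τ v i → eval (factor σ τ i) v
    ≡ (if lookup σ i then lookup v i else (if lookup τ i then not (lookup v i) else true))
  eval-factor σ τ v i with lookup σ i | lookup τ i
  ... | true | _ = eval-x i v
  ... | false | true = trans (eval-additive v 1P (x i)) (cong₂ _xor_ (eval-1P v) (eval-x i v))
  ... | false | false = eval-1P v

  eval-prodP⁻ : ∀ v (ps : List (Poly n)) → eval (prodP ps) v ≡ true → All (λ p → eval p v ≡ true) ps
  eval-prodP⁻ v [] _ = []
  eval-prodP⁻ v (p ∷ ps) e =
    BoolP.∧-conicalˡ _ _ e′ ∷ eval-prodP⁻ v ps (BoolP.∧-conicalʳ _ _ e′)
    where e′ = trans (sym (eval-*P p (prodP ps) v)) e

  eval-prodP⁺ : ∀ v (ps : List (Poly n)) → All (λ p → eval p v ≡ true) ps → eval (prodP ps) v ≡ true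
  eval-prodP⁺ v [] [] = eval-1P v
  eval-prodP⁺ v (p ∷ ps) (e ∷ es) = trans (eval-*P p (prodP ps) v) (cong₂ _∧_ e (eval-prodP⁺ v ps es))

  eval-pm⇒Matches : ∀ {σ τ} v → Disjoint σ τ → eval (pm σ τ) v ≡ true → Matches σ τ v
  eval-pm⇒Matches {σ} {τ} v d e = (λ i∈σ → in-σ (∈⇒lookup i∈σ)) , λ i∈τ → out-τ (∉⇒lookup (λ i∈σ → Disjoint-∉ d i∈σ i∈τ)) (∈⇒lookup i∈τ)
    where
    factor-true : ∀ i → eval (factor σ τ i) v ≡ true
    factor-true i = All.lookup (AllP.map⁻ (eval-prodP⁻ v (map (factor σ τ) (allFin n)) e)) (∈-allFin i)
    in-σ : ∀ {i} → lookup σ i ≡ true → i ∈ v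
    in-σ {i} σi with factor-true i
    ... | t rewrite eval-factor σ τ v i | σi = lookup⇒∈ t
    out-τ : ∀ {i} → lookup σ i ≡ false → lookup τ i ≡ true → i ∉ v
    out-τ {i} σi τi i∈v with factor-true i
    ... | t rewrite eval-factor σ τ v i | σi | τi | ∈⇒lookup i∈v = case t of λ ()

  Matches⇒eval-pm : ∀ {σ τ} v → Matches σ τ v → eval (pm σ τ) v ≡ true
  Matches⇒eval-pm {σ} {τ} v (σ⊆v , τ∩v≡∅) = eval-prodP⁺ v (map (factor σ τ) (allFin n)) (AllP.map⁺ (All.universal factor-true (allFin n)))
    where
    factor-true : ∀ i → eval (factor σ τ i) v ≡ true
    factor-true i rewrite eval-factor σ τ v i with lookup σ i in σi | lookup τ i in τi
    ... | true | _ = ∈⇒lookup (σ⊆v (lookup⇒∈ σi))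
    ... | false | true rewrite ∉⇒lookup (τ∩v≡∅ (lookup⇒∈ τi)) = refl
    ... | false | false = refl

  Matches-self : ∀ {σ τ} → Disjoint σ τ → Matches σ τ σ
  Matches-self d = (λ i∈σ → i∈σ) , λ i∈τ i∈σ → Disjoint-∉ d i∈σ i∈τ

  Matches-∁ : ∀ {σ τ} → Disjoint σ τ → Matches σ τ (∁ τ)
  Matches-∁ d = (λ i∈σ → x∉p⇒x∈∁p (Disjoint-∉ d i∈σ)) , x∈p⇒x∉∁p

  Matches-ρ : ∀ {σ c} → Matches σ (∁ σ) c → c ≡ σ
  Matches-ρ {σ} {c} (σ⊆c , ∁σ∩c≡∅) = ⊆-antisym c⊆σ σ⊆c
    where
    c⊆σ : c ⊆ σ
    c⊆σ {i} i∈c with i ∈? σ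
    ... | yes i∈σ = i∈σ
    ... | no i∉σ = ⊥-elim (∁σ∩c≡∅ (x∉p⇒x∈∁p i∉σ) i∈c)

  Matches? : ∀ (σ τ v : Subset n) → Dec (Matches σ τ v)
  Matches? σ τ v with σ ⊆? v | nonempty? (τ ∩ v)
  ... | no σ⊈v | _ = no (σ⊈v ∘ proj₁)
  ... | yes σ⊆v | no τ∩v≡∅ = yes (σ⊆v , λ i∈τ i∈v → τ∩v≡∅ (_ , x∈p∩q⁺ (i∈τ , i∈v)))
  ... | yes _ | yes (i , i∈τ∩v) = no λ (_ , τ∩v≡∅) → uncurry τ∩v≡∅ (x∈p∩q⁻ τ v i∈τ∩v)

  -- Evaluate the divisibility at the two extreme points σ and ∁ τ of the box of (σ , τ).
  pm∣pm⇒⊆ : ∀ {σ τ σ′ τ′} → Disjoint σ τ → Disjoint σ′ τ′ → pm σ′ τ′ ∣P pm σ τ → σ′ ⊆ σ × τ′ ⊆ τ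
  pm∣pm⇒⊆ {σ} {τ} {σ′} {τ′} d d′ (h , pm≈pm*h) =
    proj₁ (matches′ σ (Matches-self d)) , λ i∈τ′ → x∉∁p⇒x∈p (proj₂ (matches′ (∁ τ) (Matches-∁ d)) i∈τ′)
    where
    matches′ : ∀ v → Matches σ τ v → Matches σ′ τ′ v
    matches′ v m = eval-pm⇒Matches v d′ (BoolP.∧-conicalˡ _ _ (begin
      eval (pm σ′ τ′) v ∧ eval h v  ≡⟨ eval-*P (pm σ′ τ′) h v ⟨
      eval (pm σ′ τ′ *P h) v        ≡⟨ eval-resp-≈ (pm σ τ) (pm σ′ τ′ *P h) v pm≈pm*h ⟨
      eval (pm σ τ) v               ≡⟨ Matches⇒eval-pm v m ⟩
      true                          ∎))
      where open ≡-Reasoning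

  -- Multilinearity of the product, used at the unique occurrence of k.
  prodP-split : ∀ {A : Set} (f f₁ f₂ : A → Poly n) {k} →
    (∀ {j} → j ≢ k → f j ≡ f₁ j) → (∀ {j} → j ≢ k → f j ≡ f₂ j) → f k ≋ f₁ k ++ f₂ k →
    ∀ {l} → Unique l → k ∈ₗ l → prodP (map f l) ≋ prodP (map f₁ l) ++ prodP (map f₂ l)
  prodP-split f f₁ f₂ {k} f≡f₁ f≡f₂ split {k ∷ l} (k∉l ∷ _) (here refl) = begin
    f k *P prodP (map f l)                                          ≈⟨ *P-congʳ _ split ⟩
    (f₁ k ++ f₂ k) *P prodP (map f l)                               ≡⟨ *P-distribʳ-++ (f₁ k) (f₂ k) _ ⟩
    f₁ k *P prodP (map f l) ++ f₂ k *P prodP (map f l)              ≡⟨ cong₂ (λ l₁ l₂ → f₁ k *P prodP l₁ ++ f₂ k *P prodP l₂)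
                                                                         (off-k f≡f₁) (off-k f≡f₂) ⟩
    f₁ k *P prodP (map f₁ l) ++ f₂ k *P prodP (map f₂ l)            ∎
    where
    open ≋-Reasoning
    off-k : ∀ {g} → (∀ {j} → j ≢ k → f j ≡ g j) → map f l ≡ map g l
    off-k f≡g = ListP.map-cong-local (All.map (λ k≢j → f≡g (k≢j ∘ sym)) k∉l)
  prodP-split f f₁ f₂ {k} f≡f₁ f≡f₂ split {j ∷ l} (j∉l ∷ u) (there k∈l) = begin
    f j *P prodP (map f l)                                          ≈⟨ *P-congˡ (f j) (prodP-split f f₁ f₂ f≡f₁ f≡f₂ split u k∈l) ⟩
    f j *P (prodP (map f₁ l) ++ prodP (map f₂ l))                   ≈⟨ *P-distribˡ-++ (f j) _ _ ⟩
    f j *P prodP (map f₁ l) ++ f j *P prodP (map f₂ l)              ≡⟨ cong₂ (λ a b → a *P prodP (map f₁ l) ++ b *P prodP (map f₂ l))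
                                                                         (f≡f₁ j≢k) (f≡f₂ j≢k) ⟩
    f₁ j *P prodP (map f₁ l) ++ f₂ j *P prodP (map f₂ l)            ∎
    where
    open ≋-Reasoning
    j≢k = All.lookup j∉l k∈l

  lookup-∪⁅⁆-≢ : ∀ (p : Subset n) {k j} → j ≢ k → lookup (p ∪ ⁅ k ⁆) j ≡ lookup p j
  lookup-∪⁅⁆-≢ p {k} {j} j≢k = begin
    lookup (p ∪ ⁅ k ⁆) j        ≡⟨ VecP.lookup-zipWith _∨_ j p ⁅ k ⁆ ⟩
    lookup p j ∨ lookup ⁅ k ⁆ j ≡⟨ cong (lookup p j ∨_) (∉⇒lookup (x≢y⇒x∉⁅y⁆ j≢k)) ⟩
    lookup p j ∨ false          ≡⟨ BoolP.∨-identityʳ (lookup p j) ⟩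
    lookup p j                  ∎
    where open ≡-Reasoning

  lookup-∪⁅⁆-≡ : ∀ (p : Subset n) k → lookup (p ∪ ⁅ k ⁆) k ≡ true
  lookup-∪⁅⁆-≡ p k = ∈⇒lookup (q⊆p∪q p ⁅ k ⁆ (x∈⁅x⁆ k))

  1P≋x++1P+x : ∀ (k : Fin n) → 1P ≋ x k ++ (1P +P x k)
  1P≋x++1P+x k = mk≋ λ m → sym (begin
    oddCount m (x k ++ 1P ++ x k)                          ≡⟨ oddCount-additive m (x k) (1P ++ x k) ⟩
    oddCount m (x k) xor oddCount m (1P ++ x k)            ≡⟨ cong (oddCount m (x k) xor_) (oddCount-additive m 1P (x k)) ⟩
    oddCount m (x k) xor (oddCount m 1P xor oddCount m (x k)) ≡⟨ cong (oddCount m (x k) xor_) (BoolP.xor-comm (oddCount m 1P) _) ⟩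
    oddCount m (x k) xor (oddCount m (x k) xor oddCount m 1P) ≡⟨ xor-xor (oddCount m (x k)) (oddCount m 1P) ⟩
    oddCount m 1P                                          ∎)
    where open ≡-Reasoning

  pm-split : ∀ {σ τ k} → k ∉ σ → k ∉ τ → pm σ τ ≋ pm (σ ∪ ⁅ k ⁆) τ ++ pm σ (τ ∪ ⁅ k ⁆)
  pm-split {σ} {τ} {k} k∉σ k∉τ =
    prodP-split (factor σ τ) (factor (σ ∪ ⁅ k ⁆) τ) (factor σ (τ ∪ ⁅ k ⁆))
      (λ {j} j≢k → cong (λ b → factor′ b (lookup τ j) j) (sym (lookup-∪⁅⁆-≢ σ j≢k)))
      (λ {j} j≢k → cong (λ b → factor′ (lookup σ j) b j) (sym (lookup-∪⁅⁆-≢ τ j≢k)))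
      split-at-k (allFin⁺ n) (∈-allFin k)
    where
    factor′ : Bool → Bool → Fin n → Poly n
    factor′ s t j = if s then x j else (if t then (1P +P x j) else 1P)
    split-at-k : factor σ τ k ≋ factor (σ ∪ ⁅ k ⁆) τ k ++ factor σ (τ ∪ ⁅ k ⁆) k
    split-at-k rewrite lookup-∪⁅⁆-≡ σ k | lookup-∪⁅⁆-≡ τ k | ∉⇒lookup k∉σ | ∉⇒lookup k∉τ = 1P≋x++1P+x k

-- The ideal J_C and its canonical form

module _ {n : ℕ} (C : Code n) where

  NoCodeword : Subset n → Subset n → Set
  NoCodeword σ τ = ∀ c → c ∈C C → ¬ Matches σ τ c

  NoCodeword-mono : ∀ {σ τ σ′ τ′} → σ ⊆ σ′ → τ ⊆ τ′ → NoCodeword σ τ → NoCodeword σ′ τ′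
  NoCodeword-mono σ⊆σ′ τ⊆τ′ none c c∈C (σ′⊆c , τ′∩c≡∅) = none c c∈C (σ′⊆c ∘ σ⊆σ′ , τ′∩c≡∅ ∘ τ⊆τ′)

  private
    term : Poly n × Subset n → Poly n
    term (g , σ) = g *P ρ σ

    Generators : List (Poly n × Subset n) → Set
    Generators = All (λ gσ → C (proj₂ gσ) ≡ false)

  -- ρ σ vanishes at every point other than σ, in particular at every codeword when σ ∉ C.
  InJ-vanishes : ∀ {f} v → InJ C f → v ∈C C → eval f v ≡ false
  InJ-vanishes {f} v (gs , gens , f≈Σ) v∈C =
    trans (eval-resp-≈ f (sumP (map term gs)) v f≈Σ) (vanishes gs gens)
    where
    term-vanishes : ∀ g σ → C σ ≡ false → eval (g *P ρ σ) v ≡ false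
    term-vanishes g σ σ∉C with eval (ρ σ) v in ρσv
    ... | false = trans (eval-*P g (ρ σ) v) (trans (cong (eval g v ∧_) ρσv) (BoolP.∧-zeroʳ (eval g v)))
    ... | true with Matches-ρ (eval-pm⇒Matches v (Disjoint-∁ σ) ρσv)
    ... | refl = case trans (sym v∈C) σ∉C of λ ()
    vanishes : ∀ gs → Generators gs → eval (sumP (map term gs)) v ≡ false
    vanishes [] [] = refl
    vanishes ((g , σ) ∷ gs) (σ∉C ∷ gens) = trans (eval-additive v (term (g , σ)) _)
      (cong₂ _xor_ (term-vanishes g σ σ∉C) (vanishes gs gens))

  InJ⇒NoCodeword : ∀ {σ τ} → InJ C (pm σ τ) → NoCodeword σ τ
  InJ⇒NoCodeword {σ} {τ} pm∈J c c∈C m =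
    case trans (sym (Matches⇒eval-pm c m)) (InJ-vanishes {pm σ τ} c pm∈J c∈C) of λ ()

  InJ-resp-≋ : ∀ {p q} → p ≋ q → InJ C q → InJ C p
  InJ-resp-≋ {p} {q} p≋q (gs , gens , q≈Σ) =
    gs , gens , ≋⇒≈ (≋-trans p≋q (≈⇒≋ {p = q} {q = sumP (map term gs)} q≈Σ))

  InJ-++ : ∀ {p q} → InJ C p → InJ C q → InJ C (p ++ q)
  InJ-++ {p} {q} (gs , gens , p≈Σ) (hs , gens′ , q≈Σ) = gs ++ hs , AllP.++⁺ gens gens′ ,
    ≋⇒≈ (≋-trans (++-cong-≋ (≈⇒≋ {p = p} {q = sumP (map term gs)} p≈Σ) (≈⇒≋ {p = q} {q = sumP (map term hs)} q≈Σ))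
                 (≋-reflexive (trans (ListP.concat-++ (map term gs) (map term hs))
                                     (cong sumP (sym (ListP.map-++ term gs hs))))))

  ρ∈J : ∀ c → C c ≡ false → InJ C (ρ c)
  ρ∈J c c∉C = [ (1P , c) ] , c∉C ∷ [] ,
    ≋⇒≈ (≋-reflexive (sym (trans (ListP.++-identityʳ (1P *P ρ c)) (*P-identityˡ (ρ c)))))

  private
    -- Split along a neuron outside σ ∪ τ; once there is none, τ = ∁ σ and pm σ τ = ρ σ.
    NoCodeword⇒InJ-≤ : ∀ {N σ τ} → ∣ ∁ (σ ∪ τ) ∣ ≤ N → Disjoint σ τ → NoCodeword σ τ → InJ C (pm σ τ)
    NoCodeword⇒InJ-≤ {N} {σ} {τ} ≤N d none with nonempty? (∁ (σ ∪ τ))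
    ... | no σ∪τ-full with Disjoint-full⇒≡∁ d σ∪τ-full | C σ in σ∈?C
    ...   | refl | true = ⊥-elim (none σ σ∈?C (Matches-self d))
    ...   | refl | false = ρ∈J σ σ∈?C
    NoCodeword⇒InJ-≤ {suc N} {σ} {τ} ≤N d none | yes (k , k∈∁) =
      InJ-resp-≋ (pm-split k∉σ k∉τ) (InJ-++ {pm (σ ∪ ⁅ k ⁆) τ} {pm σ (τ ∪ ⁅ k ⁆)}
        (NoCodeword⇒InJ-≤ (shrinks (∪-mono (p⊆p∪q ⁅ k ⁆) id) (p⊆p∪q τ (q⊆p∪q σ ⁅ k ⁆ (x∈⁅x⁆ k))))
          (Disjoint-∪⁅⁆ˡ d k∉τ) (NoCodeword-mono (p⊆p∪q ⁅ k ⁆) id none))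
        (NoCodeword⇒InJ-≤ (shrinks (∪-mono id (p⊆p∪q ⁅ k ⁆)) (q⊆p∪q σ (τ ∪ ⁅ k ⁆) (q⊆p∪q τ ⁅ k ⁆ (x∈⁅x⁆ k))))
          (Disjoint-∪⁅⁆ʳ d k∉σ) (NoCodeword-mono id (p⊆p∪q ⁅ k ⁆) none)))
      where
      k∉σ∪τ = x∈∁p⇒x∉p k∈∁
      k∉σ : k ∉ σ
      k∉σ = k∉σ∪τ ∘ p⊆p∪q τ
      k∉τ : k ∉ τ
      k∉τ = k∉σ∪τ ∘ q⊆p∪q σ τ
      shrinks : ∀ {B} → σ ∪ τ ⊆ B → k ∈ B → ∣ ∁ B ∣ ≤ N
      shrinks σ∪τ⊆B k∈B = ℕP.≤-pred (ℕP.≤-trans (∣∁∣-< σ∪τ⊆B k∈B k∉σ∪τ) ≤N)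
    NoCodeword⇒InJ-≤ {zero} ≤N d none | yes (k , k∈∁) = case ℕP.≤-trans (x∈p⇒∣p-x∣<∣p∣ k∈∁) ≤N of λ ()

  NoCodeword⇒InJ : ∀ {σ τ} → Disjoint σ τ → NoCodeword σ τ → InJ C (pm σ τ)
  NoCodeword⇒InJ = NoCodeword⇒InJ-≤ ℕP.≤-refl

  InCF⇒NoCodeword : ∀ {σ τ} → InCF C σ τ → NoCodeword σ τ
  InCF⇒NoCodeword {σ} {τ} (_ , pm∈J , _) = InJ⇒NoCodeword {σ} {τ} pm∈J

  MinimalNoCodeword : Subset n → Subset n → Set
  MinimalNoCodeword σ τ = ∀ {σ′ τ′} → σ′ ⊆ σ → τ′ ⊆ τ → NoCodeword σ′ τ′ → σ ⊆ σ′ × τ ⊆ τ′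

  InCF⁺ : ∀ {σ τ} → Disjoint σ τ → NoCodeword σ τ → MinimalNoCodeword σ τ → InCF C σ τ
  InCF⁺ {σ} {τ} d none minimal = d , NoCodeword⇒InJ d none , pm-minimal
    where
    pm-minimal : ∀ σ′ τ′ → Disjoint σ′ τ′ → InJ C (pm σ′ τ′) → pm σ′ τ′ ∣P pm σ τ → pm σ′ τ′ ≈ pm σ τ
    pm-minimal σ′ τ′ d′ pm′∈J pm′∣pm with pm∣pm⇒⊆ d d′ pm′∣pm
    ... | σ′⊆σ , τ′⊆τ with minimal σ′⊆σ τ′⊆τ (InJ⇒NoCodeword {σ′} {τ′} pm′∈J)
    ... | σ⊆σ′ , τ⊆τ′ rewrite ⊆-antisym σ′⊆σ σ⊆σ′ | ⊆-antisym τ′⊆τ τ⊆τ′ = λ _ → refl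

  NoCodeword? : ∀ σ τ → Dec (NoCodeword σ τ)
  NoCodeword? σ τ with anySubset? (λ c → (C c Bool.≟ true) ×-dec Matches? σ τ c)
  ... | yes (c , c∈C , m) = no λ none → none c c∈C m
  ... | no ∄c = yes λ c c∈C m → ∄c (c , c∈C , m)

  Tight : Subset n → Subset n → Set
  Tight σ τ = (∀ {l} → l ∈ σ → ¬ NoCodeword (σ - l) τ) × (∀ {l} → l ∈ τ → ¬ NoCodeword σ (τ - l))

  Tight⇒MinimalNoCodeword : ∀ {σ τ} → Tight σ τ → MinimalNoCodeword σ τ
  Tight⇒MinimalNoCodeword {σ} {τ} (σ-tight , τ-tight) {σ′} {τ′} σ′⊆σ τ′⊆τ none′ = σ⊆σ′ , τ⊆τ′
    where
    ⊆-without : ∀ {p q : Subset n} {l} → p ⊆ q → l ∉ p → p ⊆ q - l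
    ⊆-without p⊆q l∉p {j} j∈p = x∈p∧x≢y⇒x∈p-y (p⊆q j∈p) λ { refl → l∉p j∈p }
    σ⊆σ′ : σ ⊆ σ′
    σ⊆σ′ {l} l∈σ with l ∈? σ′
    ... | yes l∈σ′ = l∈σ′
    ... | no l∉σ′ = ⊥-elim (σ-tight l∈σ (NoCodeword-mono (⊆-without σ′⊆σ l∉σ′) τ′⊆τ none′))
    τ⊆τ′ : τ ⊆ τ′
    τ⊆τ′ {l} l∈τ with l ∈? τ′
    ... | yes l∈τ′ = l∈τ′
    ... | no l∉τ′ = ⊥-elim (τ-tight l∈τ (NoCodeword-mono σ′⊆σ (⊆-without τ′⊆τ l∉τ′) none′))

  private
    -- Drop neurons from σ or τ while no codeword appears.
    InCF-below-≤ : ∀ {N σ τ} → ∣ σ ∣ + ∣ τ ∣ ≤ N → Disjoint σ τ → NoCodeword σ τ →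
                   ∃₂ λ σ′ τ′ → σ′ ⊆ σ × τ′ ⊆ τ × InCF C σ′ τ′
    InCF-below-≤ {N} {σ} {τ} ≤N d none
      with FinP.any? (λ l → (l ∈? σ) ×-dec NoCodeword? (σ - l) τ)
         | FinP.any? (λ l → (l ∈? τ) ×-dec NoCodeword? σ (τ - l))
    ... | yes (l , l∈σ , none′) | _ with N
    ...   | zero = case ℕP.≤-trans (ℕP.≤-trans (x∈p⇒∣p-x∣<∣p∣ l∈σ) (ℕP.m≤m+n ∣ σ ∣ ∣ τ ∣)) ≤N of λ ()
    ...   | suc N with InCF-below-≤ (ℕP.≤-pred (ℕP.≤-trans (ℕP.+-monoˡ-< ∣ τ ∣ (x∈p⇒∣p-x∣<∣p∣ l∈σ)) ≤N))
                     (Disjoint⁺ (Disjoint-∉ d ∘ p─q⊆p σ ⁅ l ⁆)) none′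
    ...     | σ′ , τ′ , σ′⊆ , τ′⊆τ , cf = σ′ , τ′ , p─q⊆p σ ⁅ l ⁆ ∘ σ′⊆ , τ′⊆τ , cf
    InCF-below-≤ {N} {σ} {τ} ≤N d none | no _ | yes (l , l∈τ , none′) with N
    ...   | zero = case ℕP.≤-trans (ℕP.≤-trans (x∈p⇒∣p-x∣<∣p∣ l∈τ) (ℕP.m≤n+m ∣ τ ∣ ∣ σ ∣)) ≤N of λ ()
    ...   | suc N with InCF-below-≤ (ℕP.≤-pred (ℕP.≤-trans (ℕP.+-monoʳ-< ∣ σ ∣ (x∈p⇒∣p-x∣<∣p∣ l∈τ)) ≤N))
                     (Disjoint⁺ λ i∈σ → Disjoint-∉ d i∈σ ∘ p─q⊆p τ ⁅ l ⁆) none′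
    ...     | σ′ , τ′ , σ′⊆σ , τ′⊆ , cf = σ′ , τ′ , σ′⊆σ , p─q⊆p τ ⁅ l ⁆ ∘ τ′⊆ , cf
    InCF-below-≤ {σ = σ} {τ} _ d none | no ∄σ | no ∄τ =
      σ , τ , id , id , InCF⁺ d none (Tight⇒MinimalNoCodeword ((λ l∈σ none′ → ∄σ (_ , l∈σ , none′))
                                                              , (λ l∈τ none′ → ∄τ (_ , l∈τ , none′))))

  InCF-below : ∀ {σ τ} → Disjoint σ τ → NoCodeword σ τ → ∃₂ λ σ′ τ′ → σ′ ⊆ σ × τ′ ⊆ τ × InCF C σ′ τ′
  InCF-below = InCF-below-≤ ℕP.≤-refl

-- Codes and their pair patterns

module Patterns {n : ℕ} (C : Code n) where

  Pattern : Fin n → Bool → Fin n → Bool → Set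
  Pattern i a j b = ∃[ c ] (c ∈C C × lookup c i ≡ a × lookup c j ≡ b)

  Pattern? : ∀ i a j b → Dec (Pattern i a j b)
  Pattern? i a j b = anySubset? λ c → (C c Bool.≟ true) ×-dec (lookup c i Bool.≟ a) ×-dec (lookup c j Bool.≟ b)

  Pattern-swap : ∀ {i a j b} → Pattern i a j b → Pattern j b i a
  Pattern-swap (c , c∈C , ci , cj) = c , c∈C , cj , ci

  ¬Pattern-10⇒fires : ∀ {i j} → ¬ Pattern i true j false → ∀ c → c ∈C C → i ∈ c → j ∈ c
  ¬Pattern-10⇒fires {i} {j} ∄10 c c∈C i∈c with j ∈? c
  ... | yes j∈c = j∈c
  ... | no j∉c = ⊥-elim (∄10 (c , c∈C , ∈⇒lookup i∈c , ∉⇒lookup j∉c))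

  MinimalP⁺ : ∀ {i} → (∀ {j} → j ≢ i → Pattern j true i false) → MinimalP C i
  MinimalP⁺ {i} patterns j cf@(d , _) with j Fin.≟ i
  ... | yes refl = d (i , x∈p∩q⁺ (x∈⁅x⁆ i , x∈⁅x⁆ i))
  ... | no j≢i with patterns j≢i
  ... | c , c∈C , cj , ci = InCF⇒NoCodeword C cf c c∈C
          ( (λ l∈⁅j⁆ → lookup⇒∈ (subst (λ l → lookup c l ≡ true) (sym (x∈⁅y⁆⇒x≡y j l∈⁅j⁆)) cj))
          , (λ l∈⁅i⁆ l∈c → case trans (sym (∈⇒lookup l∈c)) (subst (λ l → lookup c l ≡ false) (sym (x∈⁅y⁆⇒x≡y i l∈⁅i⁆)) ci) of λ ()))

module Code {n : ℕ} {C : Code n} (isCode : IsCode C) where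
  open IsCode isCode
  open Patterns C public

  ⊥∈C : ⊥ ∈C C
  ⊥∈C = empty∈ ⊥ λ (_ , i∈⊥) → ∉⊥ i∈⊥

  Pattern-00 : ∀ i j → Pattern i false j false
  Pattern-00 i j = ⊥ , ⊥∈C , ∉⇒lookup {i = i} ∉⊥ , ∉⇒lookup {i = j} ∉⊥

  ¬Pattern-11⇒InCF : ∀ {i j} → ¬ Pattern i true j true → InCF C (⁅ i ⁆ ∪ ⁅ j ⁆) ⊥
  ¬Pattern-11⇒InCF {i} {j} ∄11 = InCF⁺ C (Disjoint⁺ λ _ → ∉⊥) none minimal
    where
    none : NoCodeword C (⁅ i ⁆ ∪ ⁅ j ⁆) ⊥
    none c c∈C (ij⊆c , _) =
      ∄11 (c , c∈C , ∈⇒lookup (ij⊆c (p⊆p∪q ⁅ j ⁆ (x∈⁅x⁆ i))) , ∈⇒lookup (ij⊆c (q⊆p∪q ⁅ i ⁆ ⁅ j ⁆ (x∈⁅x⁆ j))))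
    minimal : MinimalNoCodeword C (⁅ i ⁆ ∪ ⁅ j ⁆) ⊥
    minimal {σ′} σ′⊆ τ′⊆⊥ none′ =
      ∪-least (⁅⁆⊆ (∈σ′ (∈⁅⁆∪⁅⁆ ∘ σ′⊆))) (⁅⁆⊆ (∈σ′ ([ inj₂ , inj₁ ]′ ∘ ∈⁅⁆∪⁅⁆ ∘ σ′⊆))) , ⊥-elim ∘ ∉⊥
      where
      ∈⁅⁆∪⁅⁆ : ∀ {l} → l ∈ ⁅ i ⁆ ∪ ⁅ j ⁆ → l ≡ i ⊎ l ≡ j
      ∈⁅⁆∪⁅⁆ {l} l∈ = Sum.map (x∈⁅y⁆⇒x≡y i) (x∈⁅y⁆⇒x≡y j) (x∈p∪q⁻ ⁅ i ⁆ ⁅ j ⁆ l∈)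
      -- Otherwise σ′ ⊆ ⁅ k′ ⁆ and any codeword containing k′ would match (σ′ , τ′).
      ∈σ′ : ∀ {k k′} → (∀ {l} → l ∈ σ′ → l ≡ k ⊎ l ≡ k′) → k ∈ σ′
      ∈σ′ {k} {k′} σ′⊆kk′ with k ∈? σ′ | covered k′
      ... | yes k∈σ′ | _ = k∈σ′
      ... | no k∉σ′ | c , c∈C , k′∈c = ⊥-elim (none′ c c∈C (σ′⊆c , λ l∈τ′ → ⊥-elim (∉⊥ (τ′⊆⊥ l∈τ′))))
        where
        σ′⊆c : σ′ ⊆ c
        σ′⊆c l∈σ′ with σ′⊆kk′ l∈σ′
        ... | inj₁ refl = ⊥-elim (k∉σ′ l∈σ′)
        ... | inj₂ refl = k′∈c

  ¬Pattern-10⇒InCF : ∀ {i j} → i ≢ j → ¬ Pattern i true j false → InCF C ⁅ i ⁆ ⁅ j ⁆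
  ¬Pattern-10⇒InCF {i} {j} i≢j ∄10 = InCF⁺ C disjoint none minimal
    where
    disjoint : Disjoint ⁅ i ⁆ ⁅ j ⁆
    disjoint = Disjoint⁺ λ l∈⁅i⁆ l∈⁅j⁆ → i≢j (trans (sym (x∈⁅y⁆⇒x≡y i l∈⁅i⁆)) (x∈⁅y⁆⇒x≡y j l∈⁅j⁆))
    none : NoCodeword C ⁅ i ⁆ ⁅ j ⁆
    none c c∈C (i⊆c , j∉c) = ∄10 (c , c∈C , ∈⇒lookup (i⊆c (x∈⁅x⁆ i)) , ∉⇒lookup (j∉c (x∈⁅x⁆ j)))
    minimal : MinimalNoCodeword C ⁅ i ⁆ ⁅ j ⁆
    minimal {σ′} {τ′} σ′⊆⁅i⁆ τ′⊆⁅j⁆ none′ = ⁅⁆⊆ i∈σ′ , ⁅⁆⊆ j∈τ′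
      where
      i∈σ′ : i ∈ σ′
      i∈σ′ with i ∈? σ′
      ... | yes i∈σ′ = i∈σ′
      ... | no i∉σ′ = ⊥-elim (none′ ⊥ ⊥∈C ((λ l∈σ′ → ⊥-elim (i∉σ′ (subst (_∈ σ′) (x∈⁅y⁆⇒x≡y i (σ′⊆⁅i⁆ l∈σ′)) l∈σ′))) , λ _ → ∉⊥))
      j∈τ′ : j ∈ τ′
      j∈τ′ with j ∈? τ′ | covered i
      ... | yes j∈τ′ | _ = j∈τ′
      ... | no j∉τ′ | c , c∈C , i∈c = ⊥-elim (none′ c c∈C
        ( (λ l∈σ′ → subst (_∈ c) (sym (x∈⁅y⁆⇒x≡y i (σ′⊆⁅i⁆ l∈σ′))) i∈c)
        , (λ l∈τ′ → ⊥-elim (j∉τ′ (subst (_∈ τ′) (x∈⁅y⁆⇒x≡y j (τ′⊆⁅j⁆ l∈τ′)) l∈τ′)))))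

  Edge⁻ : ∀ {i j} → Edge C i j → ∀ a b → Pattern i a j b
  Edge⁻ {i} {j} (i≢j , unlinked) true true with Pattern? i true j true
  ... | yes p = p
  ... | no ∄11 = ⊥-elim (unlinked (_ , _ , ¬Pattern-11⇒InCF ∄11 ,
          p⊆p∪q ⊥ (p⊆p∪q ⁅ j ⁆ (x∈⁅x⁆ i)) , p⊆p∪q ⊥ (q⊆p∪q ⁅ i ⁆ ⁅ j ⁆ (x∈⁅x⁆ j))))
  Edge⁻ {i} {j} (i≢j , unlinked) true false with Pattern? i true j false
  ... | yes p = p
  ... | no ∄10 = ⊥-elim (unlinked (_ , _ , ¬Pattern-10⇒InCF i≢j ∄10 ,
          p⊆p∪q ⁅ j ⁆ (x∈⁅x⁆ i) , q⊆p∪q ⁅ i ⁆ ⁅ j ⁆ (x∈⁅x⁆ j)))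
  Edge⁻ {i} {j} (i≢j , unlinked) false true with Pattern? j true i false
  ... | yes p = Pattern-swap p
  ... | no ∄10 = ⊥-elim (unlinked (_ , _ , ¬Pattern-10⇒InCF (i≢j ∘ sym) ∄10 ,
          q⊆p∪q ⁅ j ⁆ ⁅ i ⁆ (x∈⁅x⁆ i) , p⊆p∪q ⁅ i ⁆ (x∈⁅x⁆ j)))
  Edge⁻ {i} {j} _ false false = Pattern-00 i j

  MinimalP⁻ : ∀ {i} → MinimalP C i → ∀ {j} → j ≢ i → Pattern j true i false
  MinimalP⁻ {i} minimal {j} j≢i with Pattern? j true i false
  ... | yes p = p
  ... | no ∄10 = ⊥-elim (minimal j (¬Pattern-10⇒InCF j≢i ∄10))

module DegreeTwoCode {n : ℕ} {C : Code n} (isCode : IsCode C) (degreeTwo : DegreeTwo C) where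
  open IsCode isCode
  open Code isCode

  InCF-support : ∀ {σ τ i j} → InCF C σ τ → i ∈ σ ∪ τ → j ∈ σ ∪ τ → i ≢ j →
                 ∀ {l} → l ∈ σ ∪ τ → l ≡ i ⊎ l ≡ j
  InCF-support {σ} {τ} {i} {j} cf i∈ j∈ i≢j {l} l∈ with l Fin.≟ i | l Fin.≟ j
  ... | yes l≡i | _ = inj₁ l≡i
  ... | no _ | yes l≡j = inj₂ l≡j
  ... | no l≢i | no l≢j = ⊥-elim (ℕP.≤⇒≯ (ℕP.≤-reflexive (degreeTwo σ τ cf))
          (ℕP.≤-trans (three-elements⇒3≤∣p∣ i∈ j∈ l∈ (i≢j ∘ sym) l≢i l≢j) (∣p∪q∣≤∣p∣+∣q∣ σ τ)))

  -- A codeword agreeing with σ on the two neurons of a degree two generator would match it.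
  InCF⇒¬Pattern : ∀ {σ τ i j} → InCF C σ τ → i ∈ σ ∪ τ → j ∈ σ ∪ τ → i ≢ j →
                  ¬ Pattern i (lookup σ i) j (lookup σ j)
  InCF⇒¬Pattern {σ} {τ} {i} {j} cf@(d , _) i∈ j∈ i≢j (c , c∈C , ci , cj) =
    InCF⇒NoCodeword C cf c c∈C (σ⊆c , τ∩c≡∅)
    where
    agrees : ∀ {l} → l ∈ σ ∪ τ → lookup c l ≡ lookup σ l
    agrees l∈ with InCF-support cf i∈ j∈ i≢j l∈
    ... | inj₁ refl = ci
    ... | inj₂ refl = cj
    σ⊆c : σ ⊆ c
    σ⊆c {l} l∈σ = lookup⇒∈ (trans (agrees (p⊆p∪q τ l∈σ)) (∈⇒lookup l∈σ))
    τ∩c≡∅ : ∀ {l} → l ∈ τ → l ∉ c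
    τ∩c≡∅ {l} l∈τ l∈c = case trans (sym (∈⇒lookup l∈c))
      (trans (agrees (q⊆p∪q σ τ l∈τ)) (∉⇒lookup (flip (Disjoint-∉ d) l∈τ))) of λ ()

  Edge⁺ : ∀ {i j} → i ≢ j → (∀ a b → Pattern i a j b) → Edge C i j
  Edge⁺ {i} {j} i≢j patterns =
    i≢j , λ (σ , _ , cf , i∈ , j∈) → InCF⇒¬Pattern cf i∈ j∈ i≢j (patterns (lookup σ i) (lookup σ j))

  module _ {γ : Subset n}
           (inside : ∀ {a b} → a ∈ γ → b ∈ γ → a ≢ b → Pattern a true b true)
           (leaving : ∀ {a b} → a ∈ γ → b ∉ γ → Pattern a true b false) where

    ¬InCF-around : ∀ {σ τ} → σ ⊆ γ → τ ⊆ ∁ γ → ¬ InCF C σ τ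
    ¬InCF-around {σ} {τ} σ⊆γ τ⊆∁γ cf@(d , _) with nonempty? σ
    ... | no σ-empty =
      InCF⇒NoCodeword C cf ⊥ ⊥∈C ((λ l∈σ → ⊥-elim (σ-empty (_ , l∈σ))) , λ _ → ∉⊥)
    ... | yes (a , a∈σ) with FinP.any? (λ b → (b ∈? σ ∪ τ) ×-dec ¬? (b Fin.≟ a))
    ...   | yes (b , b∈ , b≢a) = InCF⇒¬Pattern cf (p⊆p∪q τ a∈σ) b∈ (b≢a ∘ sym) agreeing
      where
      agreeing : Pattern a (lookup σ a) b (lookup σ b)
      agreeing rewrite ∈⇒lookup a∈σ with lookup σ b in σb
      ... | true = inside (σ⊆γ a∈σ) (σ⊆γ (lookup⇒∈ σb)) (b≢a ∘ sym)
      ... | false = leaving (σ⊆γ a∈σ) (x∈∁p⇒x∉p (τ⊆∁γ b∈τ))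
        where
        b∈τ : b ∈ τ
        b∈τ = [ (λ b∈σ → case trans (sym σb) (∈⇒lookup b∈σ) of λ ()) , id ]′ (x∈p∪q⁻ σ τ b∈)
    ...   | no ∄b with covered a
    ...     | c , c∈C , a∈c = InCF⇒NoCodeword C cf c c∈C
                (σ⊆c , λ l∈τ l∈c → Disjoint-∉ d a∈σ (subst (_∈ τ) (only-a (q⊆p∪q σ τ l∈τ)) l∈τ))
      where
      only-a : ∀ {l} → l ∈ σ ∪ τ → l ≡ a
      only-a {l} l∈ with l Fin.≟ a
      ... | yes l≡a = l≡a
      ... | no l≢a = ⊥-elim (∄b (l , l∈ , l≢a))
      σ⊆c : σ ⊆ c
      σ⊆c l∈σ = subst (_∈ c) (sym (only-a (p⊆p∪q τ l∈σ))) a∈c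

    -- If γ ∉ C then (γ , ∁ γ) lies above a generator, which the patterns rule out.
    codeword⁺ : γ ∈C C
    codeword⁺ with C γ in γ∈?C
    ... | true = refl
    ... | false with InCF-below C (Disjoint-∁ γ) none
      where
      none : NoCodeword C γ (∁ γ)
      none c c∈C m with Matches-ρ m
      ... | refl = case trans (sym γ∈?C) c∈C of λ ()
    ... | σ , τ , σ⊆γ , τ⊆∁γ , cf = ⊥-elim (¬InCF-around σ⊆γ τ⊆∁γ cf)

  module Piercing {i : Fin n} {σ τ : Subset n} (σ⊆τ : σ ⊆ τ) (i∉τ : i ∉ τ)
    (interval⊆C∖i : ∀ γ → InInterval σ τ γ → γ ∈C∖ C , i)
    (C≡C∖i∪box : ∀ γ → (γ ∈C C) ⇔ ((γ ∈C∖ C , i) ⊎ InInterval (σ ∪ ⁅ i ⁆) (τ ∪ ⁅ i ⁆) γ)) where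

    C∖i⊆C : ∀ {γ} → γ ∈C∖ C , i → γ ∈C C
    C∖i⊆C γ∈ = Equivalence.from (C≡C∖i∪box _) (inj₁ γ∈)

    -- A codeword containing i is not of the form c - i, so it lies in the upper box.
    ∈C-with-i : ∀ {γ} → γ ∈C C → i ∈ γ → σ ⊆ γ × γ ⊆ τ ∪ ⁅ i ⁆
    ∈C-with-i {γ} γ∈C i∈γ with Equivalence.to (C≡C∖i∪box γ) γ∈C
    ... | inj₁ (c , _ , refl) = ⊥-elim (x∉p-x (i∈γ))
    ... | inj₂ (σ∪i⊆γ , γ⊆τ∪i) = σ∪i⊆γ ∘ p⊆p∪q ⁅ i ⁆ , γ⊆τ∪i

    lower-box⊆C : ∀ {γ} → σ ⊆ γ → γ ⊆ τ → γ ∈C C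
    lower-box⊆C σ⊆γ γ⊆τ = C∖i⊆C (interval⊆C∖i _ (σ⊆γ , γ⊆τ))

    upper-box⊆C : ∀ {γ} → σ ⊆ γ → γ ⊆ τ → (γ ∪ ⁅ i ⁆) ∈C C
    upper-box⊆C σ⊆γ γ⊆τ = Equivalence.from (C≡C∖i∪box _) (inj₂ (∪-mono σ⊆γ id , ∪-mono γ⊆τ id))

    ≢i : ∀ {j} → j ∈ τ → j ≢ i
    ≢i j∈τ refl = i∉τ j∈τ

    minimal : MinimalP C i
    minimal = MinimalP⁺ λ {j} j≢i → let (c , c∈C , j∈c) = covered j in
      c - i , C∖i⊆C (c , c∈C , refl) , ∈⇒lookup (x∈p∧x≢y⇒x∈p-y j∈c j≢i) , ∉⇒lookup (x∉p-x {p = c})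

    edge⇒∈τ─σ : ∀ {j} → Edge C i j → j ∈ τ ─ σ
    edge⇒∈τ─σ {j} e@(i≢j , _) = x∈p∧x∉q⇒x∈p─q j∈τ j∉σ
      where
      j∈τ : j ∈ τ
      j∈τ with Edge⁻ e true true
      ... | c , c∈C , ci , cj = [ id , (λ j∈⁅i⁆ → ⊥-elim (i≢j (sym (x∈⁅y⁆⇒x≡y i j∈⁅i⁆)))) ]′
                                  (x∈p∪q⁻ τ ⁅ i ⁆ (proj₂ (∈C-with-i c∈C (lookup⇒∈ ci)) (lookup⇒∈ cj)))
      j∉σ : j ∉ σ
      j∉σ j∈σ with Edge⁻ e true false
      ... | c , c∈C , ci , cj = case trans (sym cj) (∈⇒lookup (proj₁ (∈C-with-i c∈C (lookup⇒∈ ci)) j∈σ)) of λ ()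

    σ∪⁅_⁆⊆τ : ∀ {j} → j ∈ τ → σ ∪ ⁅ j ⁆ ⊆ τ
    σ∪⁅ j∈τ ⁆⊆τ = ∪-least σ⊆τ (⁅⁆⊆ j∈τ)

    ∈τ─σ⇒edge : ∀ {j} → j ∈ τ ─ σ → Edge C i j
    ∈τ─σ⇒edge {j} j∈τ─σ = Edge⁺ (≢i j∈τ ∘ sym) patterns
      where
      j∈τ = p─q⊆p τ σ j∈τ─σ
      j∉σ = x∈p─q⇒x∉q {p = τ} j∈τ─σ
      patterns : ∀ a b → Pattern i a j b
      patterns true true = (σ ∪ ⁅ j ⁆) ∪ ⁅ i ⁆ , upper-box⊆C (p⊆p∪q ⁅ j ⁆) σ∪⁅ j∈τ ⁆⊆τ ,
        ∈⇒lookup (q⊆p∪q (σ ∪ ⁅ j ⁆) ⁅ i ⁆ (x∈⁅x⁆ i)) , ∈⇒lookup (p⊆p∪q ⁅ i ⁆ (q⊆p∪q σ ⁅ j ⁆ (x∈⁅x⁆ j)))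
      patterns true false = σ ∪ ⁅ i ⁆ , upper-box⊆C id σ⊆τ ,
        ∈⇒lookup (q⊆p∪q σ ⁅ i ⁆ (x∈⁅x⁆ i)) , ∉⇒lookup (∉-∪⁅⁆ j∉σ (≢i j∈τ))
      patterns false true = σ ∪ ⁅ j ⁆ , lower-box⊆C (p⊆p∪q ⁅ j ⁆) σ∪⁅ j∈τ ⁆⊆τ ,
        ∉⇒lookup (i∉τ ∘ σ∪⁅ j∈τ ⁆⊆τ) , ∈⇒lookup (q⊆p∪q σ ⁅ j ⁆ (x∈⁅x⁆ j))
      patterns false false = Pattern-00 i j

    simplicial : Simplicial C i
    simplicial j l e e′ j≢l = Edge⁺ j≢l patterns
      where
      j∈τ─σ = edge⇒∈τ─σ e
      l∈τ─σ = edge⇒∈τ─σ e′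
      j∈τ = p─q⊆p τ σ j∈τ─σ
      l∈τ = p─q⊆p τ σ l∈τ─σ
      patterns : ∀ a b → Pattern j a l b
      patterns true true = (σ ∪ ⁅ j ⁆) ∪ ⁅ l ⁆ , lower-box⊆C (p⊆p∪q ⁅ l ⁆ ∘ p⊆p∪q ⁅ j ⁆) (∪-least σ∪⁅ j∈τ ⁆⊆τ (⁅⁆⊆ l∈τ)) ,
        ∈⇒lookup (p⊆p∪q ⁅ l ⁆ (q⊆p∪q σ ⁅ j ⁆ (x∈⁅x⁆ j))) , ∈⇒lookup (q⊆p∪q (σ ∪ ⁅ j ⁆) ⁅ l ⁆ (x∈⁅x⁆ l))
      patterns true false = σ ∪ ⁅ j ⁆ , lower-box⊆C (p⊆p∪q ⁅ j ⁆) σ∪⁅ j∈τ ⁆⊆τ ,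
        ∈⇒lookup (q⊆p∪q σ ⁅ j ⁆ (x∈⁅x⁆ j)) , ∉⇒lookup (∉-∪⁅⁆ (x∈p─q⇒x∉q {p = τ} l∈τ─σ) (j≢l ∘ sym))
      patterns false true = σ ∪ ⁅ l ⁆ , lower-box⊆C (p⊆p∪q ⁅ l ⁆) σ∪⁅ l∈τ ⁆⊆τ ,
        ∉⇒lookup (∉-∪⁅⁆ (x∈p─q⇒x∉q {p = τ} j∈τ─σ) j≢l) , ∈⇒lookup (q⊆p∪q σ ⁅ l ⁆ (x∈⁅x⁆ l))
      patterns false false = Pattern-00 j l

    neighbours : ∀ {k} → rank σ τ ≡ k → NeighbourCount C i k
    neighbours rank≡k = τ ─ σ , (λ j → mk⇔ ∈τ─σ⇒edge edge⇒∈τ─σ) , rank≡k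

  piercing⇒elimination : ∀ {i k} → IsPiercing C i k → ElimNeuron C i × NeighbourCount C i k
  piercing⇒elimination (σ , τ , σ⊆τ , i∉τ , rank≡k , interval⊆ , C≡) =
    (simplicial , minimal) , neighbours rank≡k
    where open Piercing σ⊆τ i∉τ interval⊆ C≡

  module Elimination {i : Fin n} (simplicial : Simplicial C i) (minimal : MinimalP C i)
                     {N : Subset n} (N⇔edge : ∀ j → (j ∈ N) ⇔ Edge C i j) where

    S : Subset n
    S = select λ j → ¬? (j Fin.≟ i) ×-dec ¬? (Pattern? i true j false)

    edge⇒∈N : ∀ {j} → Edge C i j → j ∈ N
    edge⇒∈N = Equivalence.from (N⇔edge _)

    ∈N⇒edge : ∀ {j} → j ∈ N → Edge C i j
    ∈N⇒edge = Equivalence.to (N⇔edge _)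

    ∈S⇒≢i : ∀ {j} → j ∈ S → j ≢ i
    ∈S⇒≢i = proj₁ ∘ ∈-select⁻ _

    ∈S⇒fires-with-i : ∀ {j} → j ∈ S → ∀ c → c ∈C C → i ∈ c → j ∈ c
    ∈S⇒fires-with-i = ¬Pattern-10⇒fires ∘ proj₂ ∘ ∈-select⁻ _

    ∉S⇒Pattern-10 : ∀ {j} → j ∉ S → j ≢ i → Pattern i true j false
    ∉S⇒Pattern-10 {j} j∉S j≢i with Pattern? i true j false
    ... | yes p = p
    ... | no ∄10 = ⊥-elim (j∉S (∈-select⁺ _ (j≢i , ∄10)))

    ∈N⇒∉S : ∀ {j} → j ∈ N → j ∉ S
    ∈N⇒∉S j∈N j∈S = proj₂ (∈-select⁻ _ j∈S) (Edge⁻ (∈N⇒edge j∈N) true false)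

    i∉S∪N : i ∉ S ∪ N
    i∉S∪N i∈S∪N = [ (λ i∈S → ∈S⇒≢i i∈S refl) , (λ i∈N → proj₁ (∈N⇒edge i∈N) refl) ]′ (x∈p∪q⁻ S N i∈S∪N)

    rank≡∣N∣ : rank S (S ∪ N) ≡ ∣ N ∣
    rank≡∣N∣ = cong ∣_∣ (⊆-antisym S∪N─S⊆N N⊆S∪N─S)
      where
      S∪N─S⊆N : (S ∪ N) ─ S ⊆ N
      S∪N─S⊆N j∈ = [ ⊥-elim ∘ x∈p─q⇒x∉q {p = S ∪ N} j∈ , id ]′ (x∈p∪q⁻ S N (p─q⊆p (S ∪ N) S j∈))
      N⊆S∪N─S : N ⊆ (S ∪ N) ─ S
      N⊆S∪N─S j∈N = x∈p∧x∉q⇒x∈p─q (q⊆p∪q S N j∈N) (∈N⇒∉S j∈N)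

    ∉S⇒∈N : ∀ {j} → j ≢ i → j ∉ S → Pattern i true j true → j ∈ N
    ∉S⇒∈N {j} j≢i j∉S p11 = edge⇒∈N (Edge⁺ (j≢i ∘ sym) patterns)
      where
      patterns : ∀ a b → Pattern i a j b
      patterns true true = p11
      patterns true false = ∉S⇒Pattern-10 j∉S j≢i
      patterns false true = Pattern-swap (MinimalP⁻ minimal j≢i)
      patterns false false = Pattern-00 i j

    Tied : Fin n → Set
    Tied u = u ≡ i ⊎ u ∈ S

    Tied⇒fires-with-i : ∀ {u} → Tied u → ∀ c → c ∈C C → i ∈ c → u ∈ c
    Tied⇒fires-with-i (inj₁ refl) c _ i∈c = i∈c
    Tied⇒fires-with-i (inj₂ u∈S) = ∈S⇒fires-with-i u∈S

    fires-with-i : ∀ {x} → Tied x ⊎ x ∈ N → Pattern i true x true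
    fires-with-i (inj₁ tied) = let (c , c∈C , i∈c) = covered i in
      c , c∈C , ∈⇒lookup i∈c , ∈⇒lookup (Tied⇒fires-with-i tied c c∈C i∈c)
    fires-with-i (inj₂ x∈N) = Edge⁻ (∈N⇒edge x∈N) true true

    module _ {γ : Subset n} (i∈γ : i ∈ γ) (S⊆γ : S ⊆ γ) (γ⊆S∪N∪i : γ ⊆ (S ∪ N) ∪ ⁅ i ⁆) where

      classify : ∀ {x} → x ∈ γ → Tied x ⊎ x ∈ N
      classify x∈γ with x∈p∪q⁻ (S ∪ N) ⁅ i ⁆ (γ⊆S∪N∪i x∈γ)
      ... | inj₁ x∈S∪N = [ inj₁ ∘ inj₂ , inj₂ ]′ (x∈p∪q⁻ S N x∈S∪N)
      ... | inj₂ x∈⁅i⁆ = inj₁ (inj₁ (x∈⁅y⁆⇒x≡y i x∈⁅i⁆))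

      inside : ∀ {a b} → a ∈ γ → b ∈ γ → a ≢ b → Pattern a true b true
      inside {a} {b} a∈γ b∈γ a≢b with classify a∈γ | classify b∈γ
      ... | inj₁ tied | b-class = let (c , c∈C , ci , cb) = fires-with-i b-class in
        c , c∈C , ∈⇒lookup (Tied⇒fires-with-i tied c c∈C (lookup⇒∈ ci)) , cb
      ... | a-class | inj₁ tied = let (c , c∈C , ci , ca) = fires-with-i a-class in
        c , c∈C , ca , ∈⇒lookup (Tied⇒fires-with-i tied c c∈C (lookup⇒∈ ci))
      ... | inj₂ a∈N | inj₂ b∈N = Edge⁻ (simplicial a b (∈N⇒edge a∈N) (∈N⇒edge b∈N) a≢b) true true

      leaving : ∀ {a b} → a ∈ γ → b ∉ γ → Pattern a true b false
      leaving {a} {b} a∈γ b∉γ = from-class (classify a∈γ)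
        where
        b≢i : b ≢ i
        b≢i refl = b∉γ i∈γ
        from-class : Tied a ⊎ a ∈ N → Pattern a true b false
        from-class (inj₁ tied) = let (c , c∈C , ci , cb) = ∉S⇒Pattern-10 (b∉γ ∘ S⊆γ) b≢i in
          c , c∈C , ∈⇒lookup (Tied⇒fires-with-i tied c c∈C (lookup⇒∈ ci)) , cb
        from-class (inj₂ a∈N) with b ∈? N | Pattern? a true b false
        ... | yes b∈N | _ = Edge⁻ (simplicial a b (∈N⇒edge a∈N) (∈N⇒edge b∈N) λ { refl → b∉γ a∈γ }) true false
        ... | no _ | yes p = p
        -- Here b fires whenever a does, and a fires together with i.
        ... | no b∉N | no ∄10 with Edge⁻ (∈N⇒edge a∈N) true true
        ...   | c , c∈C , ci , ca =
          ⊥-elim (b∉N (∉S⇒∈N b≢i (b∉γ ∘ S⊆γ) (c , c∈C , ci , ∈⇒lookup (¬Pattern-10⇒fires ∄10 c c∈C (lookup⇒∈ ca)))))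

      upper-box⊆C : γ ∈C C
      upper-box⊆C = codeword⁺ inside leaving

    without-i : ∀ {c} → c ∈C C → (c - i) ∈C C
    without-i {c} c∈C = codeword⁺ inside-c-i leaving-c-i
      where
      inside-c-i : ∀ {a b} → a ∈ c - i → b ∈ c - i → a ≢ b → Pattern a true b true
      inside-c-i a∈ b∈ _ = c , c∈C , ∈⇒lookup (p─q⊆p c ⁅ i ⁆ a∈) , ∈⇒lookup (p─q⊆p c ⁅ i ⁆ b∈)
      leaving-c-i : ∀ {a b} → a ∈ c - i → b ∉ c - i → Pattern a true b false
      leaving-c-i {a} {b} a∈ b∉ with b Fin.≟ i
      ... | yes refl = MinimalP⁻ minimal λ { refl → x∉p-x {p = c} a∈ }
      ... | no b≢i = c , c∈C , ∈⇒lookup (p─q⊆p c ⁅ i ⁆ a∈) , ∉⇒lookup (λ b∈c → b∉ (x∈p∧x≢y⇒x∈p-y b∈c b≢i))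

    ∈C-with-i : ∀ {γ} → γ ∈C C → i ∈ γ → InInterval (S ∪ ⁅ i ⁆) ((S ∪ N) ∪ ⁅ i ⁆) γ
    ∈C-with-i {γ} γ∈C i∈γ = ∪-least (λ j∈S → ∈S⇒fires-with-i j∈S γ γ∈C i∈γ) (⁅⁆⊆ i∈γ) , γ⊆
      where
      γ⊆ : γ ⊆ (S ∪ N) ∪ ⁅ i ⁆
      γ⊆ {x} x∈γ with x Fin.≟ i | x ∈? S
      ... | yes refl | _ = q⊆p∪q (S ∪ N) ⁅ i ⁆ (x∈⁅x⁆ i)
      ... | no _ | yes x∈S = p⊆p∪q ⁅ i ⁆ (p⊆p∪q N x∈S)
      ... | no x≢i | no x∉S = p⊆p∪q ⁅ i ⁆ (q⊆p∪q S N
            (∉S⇒∈N x≢i x∉S (γ , γ∈C , ∈⇒lookup i∈γ , ∈⇒lookup x∈γ)))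

    interval⊆C∖i : ∀ γ → InInterval S (S ∪ N) γ → γ ∈C∖ C , i
    interval⊆C∖i γ (S⊆γ , γ⊆S∪N) = γ ∪ ⁅ i ⁆ ,
      upper-box⊆C (q⊆p∪q γ ⁅ i ⁆ (x∈⁅x⁆ i)) (p⊆p∪q ⁅ i ⁆ ∘ S⊆γ) (∪-mono γ⊆S∪N id) ,
      sym (p∪⁅x⁆-x≡p (i∉S∪N ∘ γ⊆S∪N))

    C≡C∖i∪box : ∀ γ → (γ ∈C C) ⇔ ((γ ∈C∖ C , i) ⊎ InInterval (S ∪ ⁅ i ⁆) ((S ∪ N) ∪ ⁅ i ⁆) γ)
    C≡C∖i∪box γ = mk⇔ to from
      where
      to : γ ∈C C → (γ ∈C∖ C , i) ⊎ InInterval (S ∪ ⁅ i ⁆) ((S ∪ N) ∪ ⁅ i ⁆) γ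
      to γ∈C with i ∈? γ
      ... | no i∉γ = inj₁ (γ , γ∈C , sym (p-x≡p i∉γ))
      ... | yes i∈γ = inj₂ (∈C-with-i γ∈C i∈γ)
      from : (γ ∈C∖ C , i) ⊎ InInterval (S ∪ ⁅ i ⁆) ((S ∪ N) ∪ ⁅ i ⁆) γ → γ ∈C C
      from (inj₁ (c , c∈C , refl)) = without-i c∈C
      from (inj₂ (S∪i⊆γ , γ⊆)) = upper-box⊆C (S∪i⊆γ (q⊆p∪q S ⁅ i ⁆ (x∈⁅x⁆ i))) (S∪i⊆γ ∘ p⊆p∪q ⁅ i ⁆) γ⊆

  elimination⇒piercing : ∀ {i k} → ElimNeuron C i × NeighbourCount C i k → IsPiercing C i k
  elimination⇒piercing ((simplicial , minimal) , N , N⇔edge , ∣N∣≡k) =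
    S , S ∪ N , p⊆p∪q N , i∉S∪N , trans rank≡∣N∣ ∣N∣≡k , interval⊆C∖i , C≡C∖i∪box
    where open Elimination simplicial minimal N⇔edge

proposition2 : ∀ (n : ℕ) (C : Code n) → IsCode C → DegreeTwo C →
               ∀ (i : Fin n) (k : ℕ) →
               IsPiercing C i k ⇔ (ElimNeuron C i × NeighbourCount C i k)
proposition2 n C isCode degreeTwo i k = mk⇔ piercing⇒elimination elimination⇒piercing
  where open DegreeTwoCode isCode degreeTwo
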